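{- For every integer $n\ge 0$: (a) $\displaystyle\sum_{k=0}^{n}(-1)^k s(k)\big(3q(n-k)-\omega(n-k)\big)=2q(n)$; (b) $\displaystyle\sum_{k=0}^{n}t(k)\big(2(-1)^{n-k}qq(n-k)-\omega'(n-k)\big)=(-1)^n qq(n)$.
   Context: A composition of $n$ is an ordered sequence of positive integers summing to $n$. $s(n)$ is the number of compositions of $n$ all of whose parts are perfect squares, and $t(n)$ the number of compositions of $n$ all of whose parts are triangular numbers $\frac{m(m+1)}{2}$ ($m\ge1$); $s(0)=t(0)=1$. $q(n)$ is the number of partitions of $n$ into distinct parts and $qq(n)$ the number of partitions of $n$ into distinct odd parts ($q(0)=qq(0)=1$). For integers $m$, $\omega(m)=1$ if $m=0$; $\omega(m)=(-1)^k$ if $m=\frac{3k^2\pm k}{2}$ for some positive integer $k$; $\omega(m)=0$ otherwise. $\omega'(n)=\omega(n/2)$ if $n$ is even and $\omega'(n)=0$ if $n$ is odd. -}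

module Defs where

open import Data.Nat as ℕ using (ℕ; zero; suc; _∸_; _≡ᵇ_; _<ᵇ_)
open import Data.Nat.DivMod using (_%_)
open import Data.Bool using (Bool; true; false; if_then_else_; _∧_; _∨_)
open import Data.List using (List; []; _∷_; [_]; map; concatMap; upTo; filter; length; foldr)
open import Data.Bool.ListAction using (any; all)
open import Data.Integer as ℤ using (ℤ; +_; -_)

-- compsF f n : all compositions of n (ordered lists of positive integers summing
-- to n), provided the fuel f is ≥ n.  First part is suc k with 0 ≤ k ≤ n-1.
compsF : ℕ → ℕ → List (List ℕ)
compsF _ zero = [ [] ]
compsF zero (suc n) = []
compsF (suc f) (suc n) =
  concatMap (λ k → map (suc k ∷_) (compsF f (n ∸ k))) (upTo (suc n))

compositions : ℕ → List (List ℕ)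
compositions n = compsF n n

countComps : (ℕ → Bool) → ℕ → ℕ
countComps p n = length (filter (λ c → Data.Bool.T? (all p c)) (compositions n))
  where import Data.Bool

isSquare : ℕ → Bool
isSquare k = any (λ m → (m ℕ.* m) ≡ᵇ k) (upTo (suc k))

isTriangular : ℕ → Bool
isTriangular k = any (λ m → (suc m ℕ.* suc (suc m)) ≡ᵇ (2 ℕ.* k)) (upTo k)

isOdd : ℕ → Bool
isOdd k = (k % 2) ≡ᵇ 1

strictDec : List ℕ → Bool
strictDec [] = true
strictDec (x ∷ []) = true
strictDec (x ∷ y ∷ xs) = (y <ᵇ x) ∧ strictDec (y ∷ xs)

s : ℕ → ℕ
s = countComps isSquare

t : ℕ → ℕ
t = countComps isTriangular

-- A partition of n into distinct parts is identified with its unique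
-- listing in strictly decreasing order, i.e. a strictly decreasing composition.
q : ℕ → ℕ
q n = length (filter (λ c → Data.Bool.T? (strictDec c)) (compositions n))
  where import Data.Bool

qq : ℕ → ℕ
qq n = length (filter (λ c → Data.Bool.T? (strictDec c ∧ all isOdd c)) (compositions n))
  where import Data.Bool

sgn : ℕ → ℤ
sgn zero = + 1
sgn (suc k) = - sgn k

omegaSearch : ℕ → List ℕ → ℤ
omegaSearch m [] = + 0
omegaSearch m (j ∷ js) =
  if ((2 ℕ.* m) ≡ᵇ (3 ℕ.* suc j ℕ.* suc j ℕ.+ suc j))
     ∨ ((2 ℕ.* m) ≡ᵇ (3 ℕ.* suc j ℕ.* suc j ∸ suc j))
  then sgn (suc j) else omegaSearch m js

-- ω(m) for m ≥ 0 (the only arguments used): 1 if m = 0, (-1)^k if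
-- m = (3k² ± k)/2 with k ≥ 1 (k is then ≤ m), 0 otherwise.
ω : ℕ → ℤ
ω zero = + 1
ω (suc m) = omegaSearch (suc m) (upTo (suc m))

ω′ : ℕ → ℤ
ω′ n = if isOdd n then + 0 else ω (n Data.Nat.DivMod./ 2)
  where import Data.Nat.DivMod

sumTo : ℕ → (ℕ → ℤ) → ℤ
sumTo n f = foldr (λ k acc → f k ℤ.+ acc) (+ 0) (upTo (suc n))

{-# OPTIONS --safe #-}
-- Write Q = ∑ q(n) xⁿ, Q̃ = ∑ (-1)ⁿ qq(n) xⁿ, E = ∑ ω(n) xⁿ, θ = 1 + 2 ∑_{m≥1} (-1)^m x^(m²) and
-- ψ = ∑_{m≥0} x^(m(m+1)/2).  Splitting off the first part of a composition shows that
-- ∑ s(n) (-x)ⁿ and ∑ t(n) xⁿ are the inverses of 1 - ∑_{m≥1} (-1)^m x^(m²) = (3 - θ)/2 and of 2 - ψ,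
-- so (a) and (b) follow from θ Q = E and ψ Q̃ = E(x²).  These come from Jacobi's triple
-- product, θ = (x;x)∞ (x;x²)∞ and ψ = (x²;x²)∞ / (x;x²)∞, together with Q = 1/(x;x²)∞, Q̃ = (x;x²)∞
-- and Euler's pentagonal theorem E = (x;x)∞, itself a third instance of the triple product.
-- The triple product is proved in the finite form
--   ∏_{k<N} (1 + A^(k+1) B^k) (1 + A^k B^(k+1)) = ∑_{i≤2N} A^(…) B^(…) [2N choose i]_{AB}
-- in an arbitrary commutative ring, and passed to the limit in ℤ⟦x⟧ coefficient by coefficient:
-- when A is divisible by x, [2N choose i]_y (y;y)_N² ≡ (y;y)_N modulo x^(min(i,2N-i)+1), y = AB.
module Submission where

open import Algebra.Bundles using (CommutativeRing)
open import Data.Nat as ℕ using (ℕ; zero; suc)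
open import Data.Integer as ℤ using (ℤ; +_; -[1+_])
import Data.Integer.Properties as ℤP
import Data.Nat.Properties as ℕP
import Relation.Binary.PropositionalEquality as ≡

import Relation.Binary.Reasoning.Setoid
module IntegerSolver {c ℓ} (R : CommutativeRing c ℓ) where

  open CommutativeRing R
  open import Data.Maybe using (Maybe; just; nothing)
  open import Data.Sign as Sign using (Sign)
  open import Relation.Nullary using (yes; no)
  open import Algebra.Solver.Ring.AlmostCommutativeRing
  open import Algebra.Properties.Ring ring using (-‿involutive; -‿distribˡ-*; -‿distribʳ-*; -‿+-comm; -0#≈0#)
  open import Algebra.Properties.Semiring.Mult.TCOptimised semiring using (_×_; ×-homo-+; ×1-homo-*)
  open import Algebra.Properties.CommutativeSemigroup *-commutativeSemigroup
    using () renaming (interchange to *-interchange)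
  open import Relation.Binary.Reasoning.Setoid setoid

  fromℕ : ℕ → Carrier
  fromℕ n = n × 1#

  fromℤ : ℤ → Carrier
  fromℤ (+ n)    = fromℕ n
  fromℤ -[1+ n ] = - fromℕ (suc n)

  fromℕ-suc : ∀ n → fromℕ (suc n) ≈ 1# + fromℕ n
  fromℕ-suc = ×-homo-+ 1# 1

  fromℤ-⊖ : ∀ m n → fromℤ (m ℤ.⊖ n) ≈ fromℕ m - fromℕ n
  fromℤ-⊖ m       zero    = sym (trans (+-congˡ -0#≈0#) (+-identityʳ _))
  fromℤ-⊖ zero    (suc n) = sym (+-identityˡ _)
  fromℤ-⊖ (suc m) (suc n) = begin
    fromℤ (suc m ℤ.⊖ suc n)             ≡⟨ ≡.cong fromℤ (ℤP.[1+m]⊖[1+n]≡m⊖n m n) ⟩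
    fromℤ (m ℤ.⊖ n)                     ≈⟨ fromℤ-⊖ m n ⟩
    fromℕ m - fromℕ n                   ≈⟨ shift-both ⟩
    (1# + fromℕ m) - (1# + fromℕ n)     ≈⟨ +-cong (fromℕ-suc m) (-‿cong (fromℕ-suc n)) ⟨
    fromℕ (suc m) - fromℕ (suc n)       ∎
    where
    shift-both : fromℕ m - fromℕ n ≈ (1# + fromℕ m) - (1# + fromℕ n)
    shift-both = begin
      fromℕ m - fromℕ n                       ≈⟨ +-identityˡ _ ⟨
      0# + (fromℕ m - fromℕ n)                ≈⟨ +-congʳ (-‿inverseʳ 1#) ⟨
      (1# - 1#) + (fromℕ m - fromℕ n)         ≈⟨ +-assoc _ _ _ ⟩
      1# + (- 1# + (fromℕ m - fromℕ n))       ≈⟨ +-congˡ (+-assoc _ _ _) ⟨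
      1# + ((- 1# + fromℕ m) - fromℕ n)       ≈⟨ +-congˡ (+-congʳ (+-comm _ _)) ⟩
      1# + ((fromℕ m - 1#) - fromℕ n)         ≈⟨ +-congˡ (+-assoc _ _ _) ⟩
      1# + (fromℕ m + (- 1# - fromℕ n))       ≈⟨ +-assoc _ _ _ ⟨
      (1# + fromℕ m) + (- 1# - fromℕ n)       ≈⟨ +-congˡ (-‿+-comm 1# (fromℕ n)) ⟩
      (1# + fromℕ m) - (1# + fromℕ n)         ∎

  fromℤ-+ : ∀ i j → fromℤ (i ℤ.+ j) ≈ fromℤ i + fromℤ j
  fromℤ-+ -[1+ m ] -[1+ n ] = begin
    - fromℕ (suc (suc (m ℕ.+ n)))           ≡⟨ ≡.cong (λ k → - fromℕ (suc k)) (ℕP.+-suc m n) ⟨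
    - fromℕ (suc m ℕ.+ suc n)               ≈⟨ -‿cong (×-homo-+ 1# (suc m) (suc n)) ⟩
    - (fromℕ (suc m) + fromℕ (suc n))       ≈⟨ -‿+-comm _ _ ⟨
    - fromℕ (suc m) - fromℕ (suc n)         ∎
  fromℤ-+ -[1+ m ] (+ n)    = trans (fromℤ-⊖ n (suc m)) (+-comm _ _)
  fromℤ-+ (+ m)    -[1+ n ] = fromℤ-⊖ m (suc n)
  fromℤ-+ (+ m)    (+ n)    = ×-homo-+ 1# m n

  fromℤ-neg : ∀ i → fromℤ (ℤ.- i) ≈ - fromℤ i
  fromℤ-neg -[1+ n ]    = sym (-‿involutive _)
  fromℤ-neg (+ zero)    = sym -0#≈0#
  fromℤ-neg (+ suc n)   = refl

  fromSign : Sign → Carrier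
  fromSign Sign.+ = 1#
  fromSign Sign.- = - 1#

  fromSign-* : ∀ s t → fromSign (s Sign.* t) ≈ fromSign s * fromSign t
  fromSign-* Sign.+ t      = sym (*-identityˡ _)
  fromSign-* Sign.- Sign.+ = sym (*-identityʳ _)
  fromSign-* Sign.- Sign.- = begin
    1#               ≈⟨ -‿involutive _ ⟨
    - - 1#           ≈⟨ -‿cong (*-identityʳ _) ⟨
    - (- 1# * 1#)    ≈⟨ -‿distribʳ-* _ _ ⟩
    - 1# * - 1#      ∎

  fromℤ-◃ : ∀ s n → fromℤ (s ℤ.◃ n) ≈ fromSign s * fromℕ n
  fromℤ-◃ s      zero    = sym (zeroʳ _)
  fromℤ-◃ Sign.+ (suc n) = sym (*-identityˡ _)
  fromℤ-◃ Sign.- (suc n) = trans (-‿cong (sym (*-identityˡ _))) (-‿distribˡ-* _ _)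

  fromℤ-signAbs : ∀ i → fromℤ i ≈ fromSign (ℤ.sign i) * fromℕ ℤ.∣ i ∣
  fromℤ-signAbs i = trans (reflexive (≡.cong fromℤ (≡.sym (ℤP.◃-inverse i)))) (fromℤ-◃ (ℤ.sign i) ℤ.∣ i ∣)

  fromℤ-* : ∀ i j → fromℤ (i ℤ.* j) ≈ fromℤ i * fromℤ j
  fromℤ-* i j = begin
    fromℤ (i ℤ.* j)                     ≈⟨ fromℤ-◃ (s Sign.* t) (m ℕ.* n) ⟩
    fromSign (s Sign.* t) * fromℕ (m ℕ.* n)  ≈⟨ *-cong (fromSign-* s t) (×1-homo-* m n) ⟩
    (fromSign s * fromSign t) * (fromℕ m * fromℕ n)  ≈⟨ *-interchange _ _ _ _ ⟩
    (fromSign s * fromℕ m) * (fromSign t * fromℕ n)  ≈⟨ *-cong (fromℤ-signAbs i) (fromℤ-signAbs j) ⟨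
    fromℤ i * fromℤ j                   ∎
    where
    s = ℤ.sign i ; t = ℤ.sign j ; m = ℤ.∣ i ∣ ; n = ℤ.∣ j ∣

  fromℤ-morphism : ℤ.+-*-rawRing -Raw-AlmostCommutative⟶ fromCommutativeRing R
  fromℤ-morphism = record
    { ⟦_⟧ = fromℤ ; +-homo = fromℤ-+ ; *-homo = fromℤ-* ; -‿homo = fromℤ-neg
    ; 0-homo = refl ; 1-homo = refl }

  fromℤ-≟ : ∀ i j → Maybe (fromℤ i ≈ fromℤ j)
  fromℤ-≟ i j with i ℤ.≟ j
  ... | yes i≡j = just (reflexive (≡.cong fromℤ i≡j))
  ... | no _    = nothing

  open import Algebra.Solver.Ring ℤ.+-*-rawRing (fromCommutativeRing R) fromℤ-morphism fromℤ-≟ public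

module FiniteSums {c ℓ} (R : CommutativeRing c ℓ) where

  open CommutativeRing R
  open import Algebra.Properties.CommutativeSemigroup +-commutativeSemigroup
    using () renaming (interchange to +-interchange)

  ∑ : ℕ → (ℕ → Carrier) → Carrier
  ∑ zero    f = 0#
  ∑ (suc n) f = f 0 + ∑ n (λ k → f (suc k))

  ∑-cong-< : ∀ n {f g} → (∀ k → k ℕ.< n → f k ≈ g k) → ∑ n f ≈ ∑ n g
  ∑-cong-< zero    f≈g = refl
  ∑-cong-< (suc n) f≈g = +-cong (f≈g 0 (ℕ.s≤s ℕ.z≤n)) (∑-cong-< n (λ k k<n → f≈g (suc k) (ℕ.s≤s k<n)))

  ∑-cong : ∀ n {f g} → (∀ k → f k ≈ g k) → ∑ n f ≈ ∑ n g
  ∑-cong n f≈g = ∑-cong-< n (λ k _ → f≈g k)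

  ∑-zero : ∀ n {f} → (∀ k → f k ≈ 0#) → ∑ n f ≈ 0#
  ∑-zero zero    f≈0 = refl
  ∑-zero (suc n) f≈0 = trans (+-cong (f≈0 0) (∑-zero n (λ k → f≈0 (suc k)))) (+-identityˡ 0#)

  ∑-distrib-+ : ∀ n f g → ∑ n (λ k → f k + g k) ≈ ∑ n f + ∑ n g
  ∑-distrib-+ zero    f g = sym (+-identityˡ 0#)
  ∑-distrib-+ (suc n) f g =
    trans (+-congˡ (∑-distrib-+ n (λ k → f (suc k)) (λ k → g (suc k)))) (+-interchange _ _ _ _)

  *-distribˡ-∑ : ∀ n f a → ∑ n (λ k → a * f k) ≈ a * ∑ n f
  *-distribˡ-∑ zero    f a = sym (zeroʳ a)
  *-distribˡ-∑ (suc n) f a = trans (+-congˡ (*-distribˡ-∑ n (λ k → f (suc k)) a)) (sym (distribˡ a _ _))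

  *-distribʳ-∑ : ∀ n f a → ∑ n (λ k → f k * a) ≈ ∑ n f * a
  *-distribʳ-∑ zero    f a = sym (zeroˡ a)
  *-distribʳ-∑ (suc n) f a = trans (+-congˡ (*-distribʳ-∑ n (λ k → f (suc k)) a)) (sym (distribʳ a _ _))

  ∑-split : ∀ m n f → ∑ (m ℕ.+ n) f ≈ ∑ m f + ∑ n (λ k → f (m ℕ.+ k))
  ∑-split zero    n f = sym (+-identityˡ _)
  ∑-split (suc m) n f = trans (+-congˡ (∑-split m n (λ k → f (suc k)))) (sym (+-assoc _ _ _))

  ∑-suc : ∀ n f → ∑ (suc n) f ≈ ∑ n f + f n
  ∑-suc n f = begin
    ∑ (suc n) f                  ≡⟨ ≡.cong (λ m → ∑ m f) (ℕP.+-comm 1 n) ⟩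
    ∑ (n ℕ.+ 1) f                ≈⟨ ∑-split n 1 f ⟩
    ∑ n f + (f (n ℕ.+ 0) + 0#)   ≈⟨ +-congˡ (trans (+-identityʳ _) (reflexive (≡.cong f (ℕP.+-identityʳ n)))) ⟩
    ∑ n f + f n                  ∎
    where open import Relation.Binary.Reasoning.Setoid setoid

  ∑-drop-last : ∀ n f → f n ≈ 0# → ∑ (suc n) f ≈ ∑ n f
  ∑-drop-last n f fn≈0 = trans (∑-suc n f) (trans (+-congˡ fn≈0) (+-identityʳ _))

  ∑-reverse : ∀ n f → ∑ n (λ i → f (n ℕ.∸ suc i)) ≈ ∑ n f
  ∑-reverse zero    f = refl
  ∑-reverse (suc n) f = trans (+-congˡ (∑-reverse n f)) (trans (+-comm _ _) (sym (∑-suc n f)))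

module JacobiExponents where

  open ≡ using (_≡_; refl; cong; sym; trans)
  open import Data.Nat using (_+_; _∸_; _≤_; z≤n)
  open import Data.Product using (∃-syntax; _×_; _,_)
  open import Data.Sum using (inj₁; inj₂)
  open import Data.Nat.Tactic.RingSolver using (solve-∀)

  tri : ℕ → ℕ
  tri zero    = 0
  tri (suc n) = suc n + tri n

  n≤tri : ∀ n → n ≤ tri n
  n≤tri zero    = z≤n
  n≤tri (suc n) = ℕP.m≤m+n (suc n) (tri n)

  -- The term of index i of the degree-2N expansion carries A ^ expA i N * B ^ expB i N:
  -- for i = N + k these are tri k and tri (k - 1), for i = N - K they are tri (K - 1) and tri K.
  expA : ℕ → ℕ → ℕ
  expA zero    N       = tri (N ∸ 1)
  expA (suc i) zero    = tri (suc i)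
  expA (suc i) (suc N) = expA i N

  expB : ℕ → ℕ → ℕ
  expB zero    N       = tri N
  expB (suc i) zero    = tri i
  expB (suc i) (suc N) = expB i N

  expA-above : ∀ N k → expA (N + k) N ≡ tri k
  expA-above zero    zero    = refl
  expA-above zero    (suc k) = refl
  expA-above (suc N) k       = expA-above N k

  expB-above : ∀ N k → expB (N + k) N ≡ tri (k ∸ 1)
  expB-above zero    zero    = refl
  expB-above zero    (suc k) = refl
  expB-above (suc N) k       = expB-above N k

  tri-double : ∀ k → tri k + tri k ≡ k ℕ.* suc k
  tri-double zero    = refl
  tri-double (suc k) = begin
    (suc k + tri k) + (suc k + tri k)      ≡⟨ regroup (suc k) (tri k) ⟩
    suc k + suc k + (tri k + tri k)        ≡⟨ cong (_+_ (suc k + suc k)) (tri-double k) ⟩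
    suc k + suc k + k ℕ.* suc k            ≡⟨ close k ⟩
    suc k ℕ.* suc (suc k)                  ∎
    where
    open ≡.≡-Reasoning
    regroup : ∀ a t → (a + t) + (a + t) ≡ a + a + (t + t)
    regroup = solve-∀
    close : ∀ k → suc k + suc k + k ℕ.* suc k ≡ suc k ℕ.* suc (suc k)
    close = solve-∀

  tri-+-tri-pred : ∀ k → tri k + tri (k ∸ 1) ≡ k ℕ.* k
  tri-+-tri-pred zero    = refl
  tri-+-tri-pred (suc k) = begin
    (suc k + tri k) + tri k      ≡⟨ ℕP.+-assoc (suc k) (tri k) (tri k) ⟩
    suc k + (tri k + tri k)      ≡⟨ cong (_+_ (suc k)) (tri-double k) ⟩
    suc k + k ℕ.* suc k          ≡⟨ close k ⟩
    suc k ℕ.* suc k              ∎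
    where
    open ≡.≡-Reasoning
    close : ∀ k → suc k + k ℕ.* suc k ≡ suc k ℕ.* suc k
    close = solve-∀

  expA-below : ∀ i K → expA i (i + suc K) ≡ tri K
  expA-below zero    K = refl
  expA-below (suc i) K = expA-below i K

  expB-below : ∀ i K → expB i (i + suc K) ≡ tri (suc K)
  expB-below zero    K = refl
  expB-below (suc i) K = expB-below i K

  tri-+-tri-suc : ∀ K → tri K + tri (suc K) ≡ suc K ℕ.* suc K
  tri-+-tri-suc K = trans (ℕP.+-comm (tri K) (tri (suc K))) (tri-+-tri-pred (suc K))

  expA-suc-level : ∀ i N → expA i (suc N) + i ≡ expA i N + N
  expA-suc-level zero    zero    = refl
  expA-suc-level zero    (suc N) = trans (ℕP.+-identityʳ _) (ℕP.+-comm (suc N) (tri N))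
  expA-suc-level (suc i) zero    rewrite expA-above 0 i = arith (tri i) i
    where arith : ∀ t i → t + suc i ≡ (suc i + t) + 0
          arith = solve-∀
  expA-suc-level (suc i) (suc N) =
    trans (ℕP.+-suc (expA i (suc N)) i) (trans (cong suc (expA-suc-level i N)) (sym (ℕP.+-suc (expA i N) N)))

  expB-suc-level : ∀ i N → expB i (suc N) + i ≡ expB i N + suc N
  expB-suc-level zero          N       = trans (ℕP.+-identityʳ _) (ℕP.+-comm (suc N) (tri N))
  expB-suc-level (suc zero)    zero    = refl
  expB-suc-level (suc (suc i)) zero    = arith (tri i) i
    where arith : ∀ t i → t + suc (suc i) ≡ (suc i + t) + 1
          arith = solve-∀
  expB-suc-level (suc i)       (suc N) =
    trans (ℕP.+-suc (expB i (suc N)) i) (trans (cong suc (expB-suc-level i N)) (sym (ℕP.+-suc (expB i N) (suc N))))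

  private
    halve-pred : ∀ {i j N} → suc i + suc j ≡ suc N + suc N → i + j ≡ N + N
    halve-pred {i} {j} {N} e =
      ℕP.suc-injective (trans (sym (ℕP.+-suc i j)) (trans (ℕP.suc-injective e) (ℕP.+-suc N N)))

    top-index : ∀ {i N} → suc i + 0 ≡ suc N + suc N → i ≡ N + suc N
    top-index {i} e = trans (sym (ℕP.+-identityʳ i)) (ℕP.suc-injective e)

  expA-suc-index : ∀ i j N → i + j ≡ N + N → expA (suc i) N + j ≡ expA i N + suc N
  expA-suc-index zero    j zero    e = cong suc e
  expA-suc-index zero    j (suc N) refl = shift N
    where shift : ∀ N → tri (N ∸ 1) + (suc N + suc N) ≡ tri N + suc (suc N)
          shift zero    = refl
          shift (suc N) = arith (tri N) N
            where arith : ∀ t N → t + (suc (suc N) + suc (suc N)) ≡ (suc N + t) + suc (suc (suc N))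
                  arith = solve-∀
  expA-suc-index (suc i) zero (suc N) e = begin
    expA (suc (suc i)) (suc N) + 0      ≡⟨ ℕP.+-identityʳ _ ⟩
    expA (suc i) N                      ≡⟨ cong (λ k → expA (suc k) N) (top-index e) ⟩
    expA (suc N + suc N) N              ≡⟨ cong (λ k → expA k N) (ℕP.+-suc N (suc N)) ⟨
    expA (N + suc (suc N)) N            ≡⟨ expA-above N (suc (suc N)) ⟩
    suc (suc N) + tri (suc N)           ≡⟨ ℕP.+-comm (suc (suc N)) (tri (suc N)) ⟩
    tri (suc N) + suc (suc N)           ≡⟨ cong (_+ suc (suc N)) (expA-above N (suc N)) ⟨
    expA (N + suc N) N + suc (suc N)    ≡⟨ cong (λ k → expA k N + suc (suc N)) (top-index e) ⟨
    expA (suc i) (suc N) + suc (suc N)  ∎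
    where open ≡.≡-Reasoning
  expA-suc-index (suc i) (suc j) (suc N) e =
    trans (ℕP.+-suc (expA (suc i) N) j)
          (trans (cong suc (expA-suc-index i j N (halve-pred e))) (sym (ℕP.+-suc (expA i N) (suc N))))

  expB-suc-index : ∀ i j N → i + j ≡ N + N → expB (suc i) N + j ≡ expB i N + N
  expB-suc-index zero    j zero    e = e
  expB-suc-index zero    j (suc N) refl = arith (tri N) N
    where arith : ∀ t N → t + (suc N + suc N) ≡ (suc N + t) + suc N
          arith = solve-∀
  expB-suc-index (suc i) zero (suc N) e = begin
    expB (suc (suc i)) (suc N) + 0      ≡⟨ ℕP.+-identityʳ _ ⟩
    expB (suc i) N                      ≡⟨ cong (λ k → expB (suc k) N) (top-index e) ⟩
    expB (suc N + suc N) N              ≡⟨ cong (λ k → expB k N) (ℕP.+-suc N (suc N)) ⟨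
    expB (N + suc (suc N)) N            ≡⟨ expB-above N (suc (suc N)) ⟩
    suc N + tri N                       ≡⟨ ℕP.+-comm (suc N) (tri N) ⟩
    tri N + suc N                       ≡⟨ cong (_+ suc N) (expB-above N (suc N)) ⟨
    expB (N + suc N) N + suc N          ≡⟨ cong (λ k → expB k N + suc N) (top-index e) ⟨
    expB (suc i) (suc N) + suc N        ∎
    where open ≡.≡-Reasoning
  expB-suc-index (suc i) (suc j) (suc N) e =
    trans (ℕP.+-suc (expB (suc i) N) j)
          (trans (cong suc (expB-suc-index i j N (halve-pred e))) (sym (ℕP.+-suc (expB i N) N)))

  N∸1+i≤expA : ∀ i N → N ∸ suc i ≤ expA i N
  N∸1+i≤expA zero    N       = n≤tri (N ∸ 1)
  N∸1+i≤expA (suc i) zero    = z≤n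
  N∸1+i≤expA (suc i) (suc N) = N∸1+i≤expA i N

  i∸N≤expA : ∀ i N → i ∸ N ≤ expA i N
  i∸N≤expA zero    N       rewrite ℕP.0∸n≡0 N = z≤n
  i∸N≤expA (suc i) zero    = n≤tri (suc i)
  i∸N≤expA (suc i) (suc N) = i∸N≤expA i N

  expA-depth : ∀ i j N → i + j ≡ N + N → ∃[ k ] (k ≤ i × k ≤ j × k ≤ N × N ≤ expA i N + suc k)
  expA-depth i j N i+j≡2N with ℕP.≤-total i N
  ... | inj₁ i≤N = i , ℕP.≤-refl , ℕP.≤-trans i≤N N≤j , i≤N , N≤expA+1+i
    where
    N≤j : N ≤ j
    N≤j = ℕP.+-cancelˡ-≤ i N j (≡.subst (i + N ≤_) (sym i+j≡2N) (ℕP.+-monoˡ-≤ N i≤N))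
    N≤expA+1+i : N ≤ expA i N + suc i
    N≤expA+1+i = ℕP.≤-trans (ℕP.m≤n+m∸n N (suc i))
                   (ℕP.≤-trans (ℕP.+-monoʳ-≤ (suc i) (N∸1+i≤expA i N)) (ℕP.≤-reflexive (ℕP.+-comm (suc i) (expA i N))))
  ... | inj₂ N≤i = j , ℕP.≤-trans j≤N N≤i , ℕP.≤-refl , j≤N , N≤expA+1+j
    where
    j≤N : j ≤ N
    j≤N = ℕP.+-cancelˡ-≤ N j N (≡.subst (N + j ≤_) i+j≡2N (ℕP.+-monoˡ-≤ j N≤i))
    i∸N+j≡N : (i ∸ N) + j ≡ N
    i∸N+j≡N = ℕP.+-cancelˡ-≡ N _ _
                (trans (sym (ℕP.+-assoc N (i ∸ N) j)) (trans (cong (_+ j) (ℕP.m+[n∸m]≡n N≤i)) i+j≡2N))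
    N≤expA+1+j : N ≤ expA i N + suc j
    N≤expA+1+j = ℕP.≤-trans (ℕP.≤-reflexive (sym i∸N+j≡N)) (ℕP.+-mono-≤ (i∸N≤expA i N) (ℕP.n≤1+n j))

module FiniteJacobi {ℓ₁ ℓ₂} (R : CommutativeRing ℓ₁ ℓ₂) where

  open CommutativeRing R hiding (zero)
  open IntegerSolver R using (solve; _:=_; _:+_; _:*_; _:-_; con; Polynomial)
  open FiniteSums R
  open JacobiExponents
  open import Algebra.Properties.CommutativeSemiring.Exp commutativeSemiring
    using (_^_; ^-homo-*; ^-distrib-*)
  open ≡ using (_≡_)
  open import Data.Nat using (_∸_; _<_; s≤s)
  open import Relation.Nullary using (yes; no)
  open import Algebra.Properties.CommutativeSemigroup *-commutativeSemigroup
    using (xy∙z≈xz∙y) renaming (interchange to *-interchange)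
  open import Relation.Binary.Reasoning.Setoid setoid

  :0 :1 : ∀ {n} → Polynomial n
  :0 = con (ℤ.+ 0)
  :1 = con (ℤ.+ 1)

  module Gaussian (y : Carrier) where

    gauss : ℕ → ℕ → Carrier
    gauss zero    zero    = 1#
    gauss zero    (suc k) = 0#
    gauss (suc n) zero    = 1#
    gauss (suc n) (suc k) = gauss n k + y ^ suc k * gauss n (suc k)

    gauss-vanish : ∀ n k → n < k → gauss n k ≈ 0#
    gauss-vanish zero    (suc k) _         = refl
    gauss-vanish (suc n) (suc k) (s≤s n<k) = begin
      gauss n k + y ^ suc k * gauss n (suc k)   ≈⟨ +-cong (gauss-vanish n k n<k)
                                                     (*-congˡ (gauss-vanish n (suc k) (ℕP.m<n⇒m<1+n n<k))) ⟩
      0# + y ^ suc k * 0#                       ≈⟨ trans (+-identityˡ _) (zeroʳ _) ⟩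
      0#                                        ∎

    gauss-zero : ∀ n → gauss n 0 ≈ 1#
    gauss-zero zero    = refl
    gauss-zero (suc n) = refl

    gauss-diag : ∀ n → gauss n n ≈ 1#
    gauss-diag zero    = refl
    gauss-diag (suc n) =
      trans (+-cong (gauss-diag n) (trans (*-congˡ (gauss-vanish n (suc n) (ℕP.n<1+n n))) (zeroʳ _)))
            (+-identityʳ _)

    ^-exchange : ∀ a b c d → a ℕ.+ b ≡ c ℕ.+ d → y ^ a * y ^ b ≈ y ^ c * y ^ d
    ^-exchange a b c d e = trans (sym (^-homo-* y a b)) (trans (reflexive (≡.cong (y ^_) e)) (^-homo-* y c d))

    gauss-pascal′ : ∀ i j n → i ℕ.+ j ≡ n → gauss (suc n) (suc i) ≈ y ^ j * gauss n i + gauss n (suc i)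
    gauss-pascal′ zero zero .0 ≡.refl =
      solve 1 (λ y → :1 :+ (y :* :1) :* :0 := :1 :* :1 :+ :0) refl y
    gauss-pascal′ zero (suc j) .(suc j) ≡.refl = begin
      1# + (y * 1#) * gauss (suc j) 1           ≈⟨ +-congˡ (*-congˡ (gauss-pascal′ zero j j ≡.refl)) ⟩
      1# + (y * 1#) * (y ^ j * gauss j 0 + g)   ≈⟨ +-congˡ (*-congˡ (+-congʳ (*-congˡ (gauss-zero j)))) ⟩
      1# + (y * 1#) * (y ^ j * 1# + g)          ≈⟨ solve 3 (λ y u g → :1 :+ (y :* :1) :* (u :* :1 :+ g)
                                                               := (y :* u) :* :1 :+ (:1 :+ (y :* :1) :* g))
                                                           refl y (y ^ j) g ⟩
      (y * y ^ j) * 1# + (1# + (y * 1#) * g)    ≈⟨ +-congˡ (+-congʳ (gauss-zero j)) ⟨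
      (y * y ^ j) * 1# + (gauss j 0 + (y * 1#) * g) ∎
      where g = gauss j 1
    gauss-pascal′ (suc i) zero n e = begin
      gauss n (suc i) + y ^ suc (suc i) * gauss n (suc (suc i))   ≈⟨ +-congˡ (*-congˡ vanish) ⟩
      gauss n (suc i) + y ^ suc (suc i) * 0#                      ≈⟨ solve 2 (λ a y → a :+ y :* :0 := :1 :* a :+ :0)
                                                                             refl (gauss n (suc i)) (y ^ suc (suc i)) ⟩
      1# * gauss n (suc i) + 0#                                   ≈⟨ +-congˡ vanish ⟨
      1# * gauss n (suc i) + gauss n (suc (suc i))                ∎
      where
      vanish : gauss n (suc (suc i)) ≈ 0#
      vanish = gauss-vanish n (suc (suc i))
                 (s≤s (≡.subst (ℕ._≤ suc i) e (s≤s (ℕP.≤-reflexive (ℕP.+-identityʳ i)))))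
    gauss-pascal′ (suc i) (suc j) (suc m) e = begin
      (a + y₁ * b) + y₂ * gauss (suc m) (suc (suc i))  ≈⟨ +-congˡ (*-congˡ (gauss-pascal′ (suc i) j m e₂)) ⟩
      (a + y₁ * b) + y₂ * (y ^ j * b + c)              ≈⟨ +-congˡ (solve 4 (λ y₂ yj b c → y₂ :* (yj :* b :+ c)
                                                                              := (y₂ :* yj) :* b :+ y₂ :* c)
                                                                           refl y₂ (y ^ j) b c) ⟩
      (a + y₁ * b) + ((y₂ * y ^ j) * b + y₂ * c)       ≈⟨ +-cong (gauss-pascal′ i (suc j) m e₁)
                                                            (+-congʳ (*-congʳ exchange)) ⟩
      (yⱼ * a + b) + ((yⱼ * y₁) * b + y₂ * c)          ≈⟨ solve 6 (λ yj a b y₁ y₂ c →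
                                                              (yj :* a :+ b) :+ ((yj :* y₁) :* b :+ y₂ :* c)
                                                              := yj :* (a :+ y₁ :* b) :+ (b :+ y₂ :* c))
                                                            refl yⱼ a b y₁ y₂ c ⟩
      yⱼ * (a + y₁ * b) + (b + y₂ * c)                 ∎
      where
      a = gauss m i ; b = gauss m (suc i) ; c = gauss m (suc (suc i))
      y₁ = y ^ suc i ; y₂ = y ^ suc (suc i) ; yⱼ = y ^ suc j
      e₁ : i ℕ.+ suc j ≡ m
      e₁ = ℕP.suc-injective e
      e₂ : suc i ℕ.+ j ≡ m
      e₂ = ≡.trans (≡.sym (ℕP.+-suc i j)) e₁
      exchange : y₂ * y ^ j ≈ yⱼ * y₁
      exchange = ^-exchange (suc (suc i)) j (suc j) (suc i)
                   (≡.cong suc (≡.trans (≡.cong suc (ℕP.+-comm i j)) (≡.sym (ℕP.+-suc j i))))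

    gauss-step₂ : ∀ j r M → j ℕ.+ r ≡ M →
      gauss (suc (suc M)) (suc (suc j)) ≈
        y ^ r * gauss M j + (1# + y ^ suc M) * gauss M (suc j) + y ^ suc (suc j) * gauss M (suc (suc j))
    gauss-step₂ j r M e = begin
      gauss (suc M) (suc j) + y₂ * (b + y₂ * c)    ≈⟨ +-cong (gauss-pascal′ j r M e) (lower r e) ⟩
      (y ^ r * a + b) + (y ^ suc M * b + y₂ * c)   ≈⟨ solve 6 (λ yr a b ym y₂ c →
                                                         (yr :* a :+ b) :+ (ym :* b :+ y₂ :* c)
                                                         := yr :* a :+ (:1 :+ ym) :* b :+ y₂ :* c)
                                                       refl (y ^ r) a b (y ^ suc M) y₂ c ⟩
      y ^ r * a + (1# + y ^ suc M) * b + y₂ * c    ∎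
      where
      a = gauss M j ; b = gauss M (suc j) ; c = gauss M (suc (suc j)) ; y₂ = y ^ suc (suc j)
      lower : ∀ r → j ℕ.+ r ≡ M → y₂ * (b + y₂ * c) ≈ y ^ suc M * b + y₂ * c
      lower zero e₀ = begin
        y₂ * (b + y₂ * c)               ≈⟨ *-congˡ (+-cong b≈0 (*-congˡ c≈0)) ⟩
        y₂ * (0# + y₂ * 0#)             ≈⟨ solve 2 (λ y₂ ym → y₂ :* (:0 :+ y₂ :* :0) := ym :* :0 :+ y₂ :* :0)
                                                   refl y₂ (y ^ suc M) ⟩
        y ^ suc M * 0# + y₂ * 0#        ≈⟨ +-cong (*-congˡ b≈0) (*-congˡ c≈0) ⟨
        y ^ suc M * b + y₂ * c          ∎
        where
        M<1+j : M < suc j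
        M<1+j = s≤s (ℕP.≤-reflexive (≡.trans (≡.sym e₀) (ℕP.+-identityʳ j)))
        b≈0 = gauss-vanish M (suc j) M<1+j
        c≈0 = gauss-vanish M (suc (suc j)) (ℕP.m<n⇒m<1+n M<1+j)
      lower (suc r) e₁ = begin
        y₂ * (b + y₂ * c)               ≈⟨ *-congˡ (gauss-pascal′ (suc j) r M e′) ⟩
        y₂ * (y ^ r * b + c)            ≈⟨ solve 4 (λ y₂ yr b c → y₂ :* (yr :* b :+ c) := (y₂ :* yr) :* b :+ y₂ :* c)
                                                   refl y₂ (y ^ r) b c ⟩
        (y₂ * y ^ r) * b + y₂ * c       ≈⟨ +-congʳ (*-congʳ (sym (^-homo-* y (suc (suc j)) r))) ⟩
        y ^ (suc (suc j) ℕ.+ r) * b + y₂ * c  ≡⟨ ≡.cong (λ k → y ^ suc k * b + y₂ * c) e′ ⟩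
        y ^ suc M * b + y₂ * c          ∎
        where
        e′ : suc j ℕ.+ r ≡ M
        e′ = ≡.trans (≡.sym (ℕP.+-suc j r)) e₁

    gauss-step₂-one : ∀ M → gauss (suc (suc M)) 1 ≈ (1# + y ^ suc M) + y ^ 1 * gauss M 1
    gauss-step₂-one M = begin
      1# + y ^ 1 * gauss (suc M) 1                 ≈⟨ +-congˡ (*-congˡ (trans (gauss-pascal′ zero M M ≡.refl)
                                                                          (+-congʳ (*-congˡ (gauss-zero M))))) ⟩
      1# + (y * 1#) * (y ^ M * 1# + gauss M 1)     ≈⟨ solve 3 (λ y ym b → :1 :+ (y :* :1) :* (ym :* :1 :+ b)
                                                                    := (:1 :+ y :* ym) :+ (y :* :1) :* b)
                                                                refl y (y ^ M) (gauss M 1) ⟩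
      (1# + y * y ^ M) + (y * 1#) * gauss M 1      ∎

    poch : ℕ → Carrier
    poch zero    = 1#
    poch (suc m) = poch m * (1# - y ^ suc m)

    gauss-poch : ∀ i j → gauss (i ℕ.+ j) i * poch i * poch j ≈ poch (i ℕ.+ j)
    gauss-poch zero j =
      trans (*-congʳ (*-congʳ (gauss-zero j))) (solve 1 (λ e → :1 :* :1 :* e := e) refl (poch j))
    gauss-poch (suc i) zero rewrite ℕP.+-identityʳ i =
      trans (*-congʳ (*-congʳ (gauss-diag (suc i)))) (solve 1 (λ e → :1 :* e :* :1 := e) refl (poch (suc i)))
    gauss-poch (suc i) (suc j) rewrite ℕP.+-suc i j = begin
      (gauss n i + y₁ * gauss n (suc i)) * (poch i * (1# - y₁)) * (poch j * (1# - yⱼ))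
        ≈⟨ solve 6 (λ a b pi pj y₁ yj → (a :+ y₁ :* b) :* (pi :* (:1 :- y₁)) :* (pj :* (:1 :- yj))
                      := (a :* pi :* (pj :* (:1 :- yj))) :* (:1 :- y₁)
                         :+ y₁ :* (b :* (pi :* (:1 :- y₁)) :* pj) :* (:1 :- yj))
                   refl (gauss n i) (gauss n (suc i)) (poch i) (poch j) y₁ yⱼ ⟩
      (gauss n i * poch i * poch (suc j)) * (1# - y₁) + y₁ * (gauss n (suc i) * poch (suc i) * poch j) * (1# - yⱼ)
        ≈⟨ +-cong (*-congʳ left) (*-congʳ (*-congˡ (gauss-poch (suc i) j))) ⟩
      poch n * (1# - y₁) + y₁ * poch n * (1# - yⱼ)
        ≈⟨ solve 3 (λ e y₁ yj → e :* (:1 :- y₁) :+ y₁ :* e :* (:1 :- yj) := e :* (:1 :- y₁ :* yj))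
                   refl (poch n) y₁ yⱼ ⟩
      poch n * (1# - y₁ * yⱼ)
        ≈⟨ *-congˡ (+-congˡ (-‿cong (^-exchange (suc i) (suc j) (suc n) 0
                                       (≡.trans (ℕP.+-suc (suc i) j) (≡.sym (ℕP.+-identityʳ (suc n))))))) ⟩
      poch n * (1# - y ^ suc n * y ^ 0)
        ≈⟨ *-congˡ (+-congˡ (-‿cong (*-identityʳ _))) ⟩
      poch n * (1# - y ^ suc n)
        ∎
      where
      n = suc (i ℕ.+ j) ; y₁ = y ^ suc i ; yⱼ = y ^ suc j
      left : gauss n i * poch i * poch (suc j) ≈ poch n
      left = ≡.subst (λ k → gauss k i * poch i * poch (suc j) ≈ poch k) (ℕP.+-suc i j) (gauss-poch i (suc j))

  module Jacobi (A B : Carrier) where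

    y : Carrier
    y = A * B

    open Gaussian y public

    monomial : ℕ → ℕ → Carrier
    monomial i N = A ^ expA i N * B ^ expB i N

    X Z : ℕ → Carrier
    X N = A ^ suc N * B ^ N
    Z N = A ^ N * B ^ suc N

    product : ℕ → Carrier
    product zero    = 1#
    product (suc N) = product N * ((1# + X N) * (1# + Z N))

    expansion : ℕ → Carrier
    expansion N = ∑ (suc (N ℕ.+ N)) (λ i → monomial i N * gauss (N ℕ.+ N) i)

    monomial-shift : ∀ a b a′ b′ p q j → a′ ℕ.+ j ≡ a ℕ.+ p → b′ ℕ.+ j ≡ b ℕ.+ q →
                     A ^ a * B ^ b * (A ^ p * B ^ q) ≈ A ^ a′ * B ^ b′ * y ^ j
    monomial-shift a b a′ b′ p q j ea eb = begin
      A ^ a * B ^ b * (A ^ p * B ^ q)        ≈⟨ *-interchange _ _ _ _ ⟩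
      (A ^ a * A ^ p) * (B ^ b * B ^ q)      ≈⟨ *-cong (^-homo-* A a p) (^-homo-* B b q) ⟨
      A ^ (a ℕ.+ p) * B ^ (b ℕ.+ q)          ≡⟨ ≡.cong₂ (λ m n → A ^ m * B ^ n) (≡.sym ea) (≡.sym eb) ⟩
      A ^ (a′ ℕ.+ j) * B ^ (b′ ℕ.+ j)        ≈⟨ *-cong (^-homo-* A a′ j) (^-homo-* B b′ j) ⟩
      (A ^ a′ * A ^ j) * (B ^ b′ * B ^ j)    ≈⟨ *-interchange _ _ _ _ ⟩
      A ^ a′ * B ^ b′ * (A ^ j * B ^ j)      ≈⟨ *-congˡ (^-distrib-* A B j) ⟨
      A ^ a′ * B ^ b′ * y ^ j                ∎

    monomial-X : ∀ i j N → i ℕ.+ j ≡ N ℕ.+ N → monomial i N * X N ≈ monomial (suc i) N * y ^ j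
    monomial-X i j N e = monomial-shift _ _ _ _ (suc N) N j (expA-suc-index i j N e) (expB-suc-index i j N e)

    monomial-Z : ∀ i N → monomial i N * Z N ≈ monomial i (suc N) * y ^ i
    monomial-Z i N = monomial-shift _ _ _ _ N (suc N) i (expA-suc-level i N) (expB-suc-level i N)

    X*Z : ∀ N → X N * Z N ≈ y ^ suc (N ℕ.+ N)
    X*Z N = trans (monomial-shift (suc N) N 0 0 N (suc N) (suc (N ℕ.+ N)) ≡.refl (≡.sym (ℕP.+-suc N N)))
                  (trans (*-congʳ (*-identityˡ 1#)) (*-identityˡ _))

    private
      module Step (N : ℕ) where

        M : ℕ
        M = N ℕ.+ N

        W : Carrier
        W = 1# + X N * Z N

        viaX viaW viaZ : ℕ → Carrier
        viaX zero          = 0#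
        viaX (suc zero)    = 0#
        viaX (suc (suc j)) = monomial j N * X N * gauss M j
        viaW zero          = 0#
        viaW (suc j)       = monomial j N * W * gauss M j
        viaZ i             = monomial i N * Z N * gauss M i

        vanishing : ∀ V k → M < k → monomial k N * V * gauss M k ≈ 0#
        vanishing V k M<k = trans (*-congˡ (gauss-vanish M k M<k)) (zeroʳ _)

        term : ∀ i → monomial i (suc N) * gauss (suc (suc M)) i ≈ viaX i + viaW i + viaZ i
        term zero = begin
          monomial 0 (suc N) * 1#                        ≈⟨ solve 1 (λ m → m :* :1 := :0 :+ :0 :+ (m :* :1) :* :1)
                                                                    refl (monomial 0 (suc N)) ⟩
          0# + 0# + (monomial 0 (suc N) * y ^ 0) * 1#    ≈⟨ +-congˡ (*-cong (monomial-Z 0 N) (gauss-zero M)) ⟨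
          0# + 0# + monomial 0 N * Z N * gauss M 0       ∎
        term (suc zero) = begin
          m₀ * gauss (suc (suc M)) 1                      ≈⟨ *-congˡ (gauss-step₂-one M) ⟩
          m₀ * ((1# + y ^ suc M) + y ^ 1 * gauss M 1)     ≈⟨ solve 4 (λ m y g w → m :* ((:1 :+ y) :+ w :* g)
                                                                       := :0 :+ m :* (:1 :+ y) :* :1 :+ (m :* w) :* g)
                                                                   refl m₀ (y ^ suc M) (gauss M 1) (y ^ 1) ⟩
          0# + m₀ * (1# + y ^ suc M) * 1# + (m₀ * y ^ 1) * gauss M 1
            ≈⟨ +-cong (+-congˡ (*-cong (*-congˡ (+-congˡ (X*Z N))) (gauss-zero M))) (*-congʳ (monomial-Z 1 N)) ⟨
          0# + m₀ * W * gauss M 0 + monomial 1 N * Z N * gauss M 1 ∎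
          where m₀ = monomial 0 N
        term (suc (suc j)) with j ℕ.≤? M
        ... | yes j≤M = begin
          m₁ * gauss (suc (suc M)) (suc (suc j))
            ≈⟨ *-congˡ (gauss-step₂ j r M e) ⟩
          m₁ * (y ^ r * a + (1# + y ^ suc M) * b + y ^ suc (suc j) * c)
            ≈⟨ solve 7 (λ m yr a ym b y₂ c → m :* (yr :* a :+ (:1 :+ ym) :* b :+ y₂ :* c)
                          := (m :* yr) :* a :+ m :* (:1 :+ ym) :* b :+ (m :* y₂) :* c)
                       refl m₁ (y ^ r) a (y ^ suc M) b (y ^ suc (suc j)) c ⟩
          (m₁ * y ^ r) * a + m₁ * (1# + y ^ suc M) * b + (m₁ * y ^ suc (suc j)) * c
            ≈⟨ +-cong (+-cong (*-congʳ (monomial-X j r N e)) (*-congʳ (*-congˡ (+-congˡ (X*Z N)))))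
                      (*-congʳ (monomial-Z (suc (suc j)) N)) ⟨
          monomial j N * X N * a + m₁ * W * b + monomial (suc (suc j)) N * Z N * c
            ∎
          where
          r = M ∸ j
          e = ℕP.m+[n∸m]≡n j≤M
          m₁ = monomial (suc j) N
          a = gauss M j ; b = gauss M (suc j) ; c = gauss M (suc (suc j))
        ... | no j≰M = begin
          monomial (suc j) N * gauss (suc (suc M)) (suc (suc j))
            ≈⟨ trans (*-congˡ (gauss-vanish _ _ (s≤s (s≤s M<j)))) (zeroʳ _) ⟩
          0#
            ≈⟨ solve 0 (:0 := :0 :+ :0 :+ :0) refl ⟩
          0# + 0# + 0#
            ≈⟨ +-cong (+-cong (vanishing (X N) j M<j) (vanishing W (suc j) M<1+j))
                      (vanishing (Z N) (suc (suc j)) (ℕP.m<n⇒m<1+n M<1+j)) ⟨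
          monomial j N * X N * gauss M j + monomial (suc j) N * W * gauss M (suc j)
            + monomial (suc (suc j)) N * Z N * gauss M (suc (suc j))
            ∎
          where
          M<j = ℕP.≰⇒> j≰M
          M<1+j = ℕP.m<n⇒m<1+n M<j

        weighted : ∀ V → ∑ (suc M) (λ j → monomial j N * V * gauss M j) ≈ expansion N * V
        weighted V = trans (∑-cong (suc M) (λ j → xy∙z≈xz∙y (monomial j N) V (gauss M j)))
                           (*-distribʳ-∑ (suc M) (λ j → monomial j N * gauss M j) V)

        ∑-viaX : ∑ (suc (suc (suc M))) viaX ≈ expansion N * X N
        ∑-viaX = trans (+-identityˡ _) (trans (+-identityˡ _) (weighted (X N)))

        ∑-viaW : ∑ (suc (suc (suc M))) viaW ≈ expansion N * W
        ∑-viaW = trans (+-identityˡ _)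
                       (trans (∑-drop-last (suc M) (λ j → monomial j N * W * gauss M j) (vanishing W (suc M) (ℕP.n<1+n M)))
                              (weighted W))

        ∑-viaZ : ∑ (suc (suc (suc M))) viaZ ≈ expansion N * Z N
        ∑-viaZ = trans (∑-drop-last (suc (suc M)) viaZ (vanishing (Z N) _ (ℕP.m<n⇒m<1+n (ℕP.n<1+n M))))
                       (trans (∑-drop-last (suc M) viaZ (vanishing (Z N) _ (ℕP.n<1+n M))) (weighted (Z N)))

    expansion-step : ∀ N → expansion (suc N) ≈ expansion N * ((1# + X N) * (1# + Z N))
    expansion-step N = begin
      expansion (suc N)
        ≡⟨ ≡.cong (λ K → ∑ (suc K) (λ i → monomial i (suc N) * gauss K i)) (≡.cong suc (ℕP.+-suc N N)) ⟩
      ∑ (suc (suc (suc M))) (λ i → monomial i (suc N) * gauss (suc (suc M)) i)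
        ≈⟨ ∑-cong (suc (suc (suc M))) term ⟩
      ∑ (suc (suc (suc M))) (λ i → viaX i + viaW i + viaZ i)
        ≈⟨ trans (∑-distrib-+ (suc (suc (suc M))) (λ i → viaX i + viaW i) viaZ)
                 (+-congʳ (∑-distrib-+ (suc (suc (suc M))) viaX viaW)) ⟩
      ∑ (suc (suc (suc M))) viaX + ∑ (suc (suc (suc M))) viaW + ∑ (suc (suc (suc M))) viaZ
        ≈⟨ +-cong (+-cong ∑-viaX ∑-viaW) ∑-viaZ ⟩
      expansion N * X N + expansion N * W + expansion N * Z N
        ≈⟨ solve 3 (λ s x z → s :* x :+ s :* (:1 :+ x :* z) :+ s :* z := s :* ((:1 :+ x) :* (:1 :+ z)))
                   refl (expansion N) (X N) (Z N) ⟩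
      expansion N * ((1# + X N) * (1# + Z N))
        ∎
      where open Step N

    finite-jacobi : ∀ N → product N ≈ expansion N
    finite-jacobi zero    = solve 0 (:1 := (:1 :* :1) :* :1 :+ :0) refl
    finite-jacobi (suc N) = trans (*-congʳ (finite-jacobi N)) (sym (expansion-step N))

    product-poch-suc : ∀ N → product (suc N) * poch (suc N) ≈
                             product N * poch N * ((1# + X N) * (1# + Z N) * (1# - y ^ suc N))
    product-poch-suc N = solve 5 (λ p x z e w → p :* ((:1 :+ x) :* (:1 :+ z)) :* (e :* (:1 :- w))
                                               := p :* e :* ((:1 :+ x) :* (:1 :+ z) :* (:1 :- w)))
                                 refl (product N) (X N) (Z N) (poch N) (y ^ suc N)

open import Data.Integer using (-_)
open ≡ using (_≡_; refl; cong; cong₂; sym; trans; subst)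
open import Data.Nat using (_∸_; _<_; _≤_; z≤n; s≤s)
open import Level using (0ℓ)

module ℤ-Sums = FiniteSums ℤP.+-*-commutativeRing
open ℤ-Sums using (∑; ∑-cong; ∑-cong-<; ∑-zero)

module PowerSeries where

  open import Data.Integer.Tactic.RingSolver using (solve-∀)
  open import Data.Product using (_,_)
  open import Data.Bool using (Bool; true; false; if_then_else_)
  open import Relation.Binary.Bundles using (Setoid)
  open import Data.Sum using (inj₁; inj₂)
  open import Function using (case_of_)

  Series : Set
  Series = ℕ → ℤ

  infix 4 _≈_
  infixl 6 _⊕_
  infixl 7 _⊛_
  infix 7.5 _·x^_
  infixr 8 x^_ ⊖_

  -- A record rather than ∀ n → f n ≡ g n, so that f and g can be inferred from a proof.
  record _≈_ (f g : Series) : Set where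
    constructor mk≈
    field coeff : ∀ n → f n ≡ g n
  open _≈_ public

  _⊕_ : Series → Series → Series
  (f ⊕ g) n = f n ℤ.+ g n

  ⊖_ : Series → Series
  (⊖ f) n = - f n

  𝟘 𝟙 : Series
  𝟘 _       = + 0
  𝟙 zero    = + 1
  𝟙 (suc _) = + 0

  _⊛_ : Series → Series → Series
  (f ⊛ g) n = ∑ (suc n) (λ k → f k ℤ.* g (n ∸ k))

  scale : ℤ → Series → Series
  scale c f n = c ℤ.* f n

  ≈-refl : ∀ {f} → f ≈ f
  ≈-refl = mk≈ (λ _ → refl)

  ≈-sym : ∀ {f g} → f ≈ g → g ≈ f
  ≈-sym f≈g = mk≈ (λ n → sym (coeff f≈g n))

  ≈-trans : ∀ {f g h} → f ≈ g → g ≈ h → f ≈ h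
  ≈-trans f≈g g≈h = mk≈ (λ n → trans (coeff f≈g n) (coeff g≈h n))

  ≡⇒≈ : ∀ {f g} → f ≡ g → f ≈ g
  ≡⇒≈ refl = ≈-refl

  ⊕-cong : ∀ {f f′ g g′} → f ≈ f′ → g ≈ g′ → f ⊕ g ≈ f′ ⊕ g′
  ⊕-cong f≈f′ g≈g′ = mk≈ (λ n → cong₂ ℤ._+_ (coeff f≈f′ n) (coeff g≈g′ n))

  ⊕-congˡ : ∀ f {g g′} → g ≈ g′ → f ⊕ g ≈ f ⊕ g′
  ⊕-congˡ f = ⊕-cong (≈-refl {f})

  ⊕-congʳ : ∀ g {f f′} → f ≈ f′ → f ⊕ g ≈ f′ ⊕ g
  ⊕-congʳ g f≈f′ = ⊕-cong f≈f′ (≈-refl {g})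

  ⊖-cong : ∀ {f g} → f ≈ g → ⊖ f ≈ ⊖ g
  ⊖-cong f≈g = mk≈ (λ n → cong -_ (coeff f≈g n))

  ⊛-cong : ∀ {f f′ g g′} → f ≈ f′ → g ≈ g′ → f ⊛ g ≈ f′ ⊛ g′
  ⊛-cong f≈f′ g≈g′ = mk≈ (λ n → ∑-cong (suc n) (λ k → cong₂ ℤ._*_ (coeff f≈f′ k) (coeff g≈g′ (n ∸ k))))

  ⊛-congˡ : ∀ f {g g′} → g ≈ g′ → f ⊛ g ≈ f ⊛ g′
  ⊛-congˡ f = ⊛-cong (≈-refl {f})

  ⊛-congʳ : ∀ g {f f′} → f ≈ f′ → f ⊛ g ≈ f′ ⊛ g
  ⊛-congʳ g f≈f′ = ⊛-cong f≈f′ (≈-refl {g})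

  ⊛-distribˡ-⊕ : ∀ f g h → f ⊛ (g ⊕ h) ≈ f ⊛ g ⊕ f ⊛ h
  ⊛-distribˡ-⊕ f g h = mk≈ λ n →
    trans (∑-cong (suc n) (λ k → ℤP.*-distribˡ-+ (f k) (g (n ∸ k)) (h (n ∸ k))))
          (ℤ-Sums.∑-distrib-+ (suc n) (λ k → f k ℤ.* g (n ∸ k)) (λ k → f k ℤ.* h (n ∸ k)))

  ⊛-distribʳ-⊕ : ∀ f g h → (g ⊕ h) ⊛ f ≈ g ⊛ f ⊕ h ⊛ f
  ⊛-distribʳ-⊕ f g h = mk≈ λ n →
    trans (∑-cong (suc n) (λ k → ℤP.*-distribʳ-+ (f (n ∸ k)) (g k) (h k)))
          (ℤ-Sums.∑-distrib-+ (suc n) (λ k → g k ℤ.* f (n ∸ k)) (λ k → h k ℤ.* f (n ∸ k)))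

  scale-⊛ : ∀ c f g → scale c f ⊛ g ≈ scale c (f ⊛ g)
  scale-⊛ c f g = mk≈ λ n →
    trans (∑-cong (suc n) (λ k → ℤP.*-assoc c (f k) (g (n ∸ k))))
          (ℤ-Sums.*-distribˡ-∑ (suc n) (λ k → f k ℤ.* g (n ∸ k)) c)

  ⊛-scale : ∀ c f g → f ⊛ scale c g ≈ scale c (f ⊛ g)
  ⊛-scale c f g = mk≈ λ n →
    trans (∑-cong (suc n) (λ k → x∙yz≈y∙xz (f k) c (g (n ∸ k))))
          (ℤ-Sums.*-distribˡ-∑ (suc n) (λ k → f k ℤ.* g (n ∸ k)) c)
    where open import Algebra.Properties.CommutativeSemigroup ℤP.*-commutativeSemigroup using (x∙yz≈y∙xz)

  ⊛-identityˡ : ∀ g → 𝟙 ⊛ g ≈ g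
  ⊛-identityˡ g = mk≈ λ where
    zero    → trans (ℤP.+-identityʳ _) (ℤP.*-identityˡ (g 0))
    (suc n) → trans (cong₂ ℤ._+_ (ℤP.*-identityˡ (g (suc n))) (∑-zero (suc n) (λ _ → refl)))
                    (ℤP.+-identityʳ _)

  ⊛-comm : ∀ f g → f ⊛ g ≈ g ⊛ f
  ⊛-comm f g = mk≈ (comm f g)
    where
    open import Algebra.Properties.CommutativeSemigroup ℤP.+-commutativeSemigroup using (x∙yz≈y∙xz)
    tail : Series → Series
    tail f k = f (suc k)
    comm : ∀ f g n → (f ⊛ g) n ≡ (g ⊛ f) n
    comm f g zero          = cong (ℤ._+ + 0) (ℤP.*-comm (f 0) (g 0))
    comm f g (suc zero)    = swap (f 0) (g 1) (f 1) (g 0)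
      where swap : ∀ a b c d → a ℤ.* b ℤ.+ (c ℤ.* d ℤ.+ + 0) ≡ d ℤ.* c ℤ.+ (b ℤ.* a ℤ.+ + 0)
            swap = solve-∀
    comm f g (suc (suc n)) = begin
      a ℤ.+ (tail f ⊛ g) (suc n)                      ≡⟨ cong (ℤ._+_ a) (comm (tail f) g (suc n)) ⟩
      a ℤ.+ (b ℤ.+ (tail g ⊛ tail f) n)               ≡⟨ x∙yz≈y∙xz a b _ ⟩
      b ℤ.+ (a ℤ.+ (tail g ⊛ tail f) n)               ≡⟨ cong (λ z → b ℤ.+ (a ℤ.+ z)) (comm (tail g) (tail f) n) ⟩
      b ℤ.+ (f ⊛ tail g) (suc n)                      ≡⟨ cong (ℤ._+_ b) (comm f (tail g) (suc n)) ⟩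
      (g ⊛ f) (suc (suc n))                           ∎
      where
      open ≡.≡-Reasoning
      a = f 0 ℤ.* g (suc (suc n))
      b = g 0 ℤ.* f (suc (suc n))

  ⊛-identityʳ : ∀ f → f ⊛ 𝟙 ≈ f
  ⊛-identityʳ f = ≈-trans (⊛-comm f 𝟙) (⊛-identityˡ f)

  ⊛-assoc : ∀ f g h → (f ⊛ g) ⊛ h ≈ f ⊛ (g ⊛ h)
  ⊛-assoc f g h = mk≈ (assoc f g h)
    where
    tail : Series → Series
    tail f k = f (suc k)
    assoc : ∀ f g h n → ((f ⊛ g) ⊛ h) n ≡ (f ⊛ (g ⊛ h)) n
    assoc f g h zero    = reassociate (f 0) (g 0) (h 0)
      where reassociate : ∀ a b c → (a ℤ.* b ℤ.+ + 0) ℤ.* c ℤ.+ + 0 ≡ a ℤ.* (b ℤ.* c ℤ.+ + 0) ℤ.+ + 0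
            reassociate = solve-∀
    -- tail (f ⊛ g) is definitionally scale (f 0) (tail g) ⊕ tail f ⊛ g.
    assoc f g h (suc n) = begin
      (f ⊛ g) 0 ℤ.* h (suc n) ℤ.+ (tail (f ⊛ g) ⊛ h) n
        ≡⟨ cong (ℤ._+_ ((f ⊛ g) 0 ℤ.* h (suc n)))
                (trans (coeff (⊛-distribʳ-⊕ h (scale (f 0) (tail g)) (tail f ⊛ g)) n)
                       (cong₂ ℤ._+_ (coeff (scale-⊛ (f 0) (tail g) h) n) (assoc (tail f) g h n))) ⟩
      (f 0 ℤ.* g 0 ℤ.+ + 0) ℤ.* h (suc n) ℤ.+ (f 0 ℤ.* (tail g ⊛ h) n ℤ.+ (tail f ⊛ (g ⊛ h)) n)
        ≡⟨ regroup (f 0) (g 0) (h (suc n)) ((tail g ⊛ h) n) ((tail f ⊛ (g ⊛ h)) n) ⟩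
      (f ⊛ (g ⊛ h)) (suc n)
        ∎
      where
      open ≡.≡-Reasoning
      regroup : ∀ a b c d e → (a ℤ.* b ℤ.+ + 0) ℤ.* c ℤ.+ (a ℤ.* d ℤ.+ e) ≡ a ℤ.* (b ℤ.* c ℤ.+ d) ℤ.+ e
      regroup = solve-∀

  ℤ⟦x⟧ : CommutativeRing 0ℓ 0ℓ
  ℤ⟦x⟧ = record
    { Carrier = Series ; _≈_ = _≈_ ; _+_ = _⊕_ ; _*_ = _⊛_ ; -_ = ⊖_ ; 0# = 𝟘 ; 1# = 𝟙
    ; isCommutativeRing = record
      { isRing = record
        { +-isAbelianGroup = record
          { isGroup = record
            { isMonoid = record
              { isSemigroup = record
                { isMagma = record
                  { isEquivalence = record { refl = ≈-refl ; sym = ≈-sym ; trans = ≈-trans }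
                  ; ∙-cong = ⊕-cong }
                ; assoc = λ f g h → mk≈ (λ n → ℤP.+-assoc (f n) (g n) (h n)) }
              ; identity = (λ f → mk≈ (λ n → ℤP.+-identityˡ (f n))) , (λ f → mk≈ (λ n → ℤP.+-identityʳ (f n))) }
            ; inverse = (λ f → mk≈ (λ n → ℤP.+-inverseˡ (f n))) , (λ f → mk≈ (λ n → ℤP.+-inverseʳ (f n)))
            ; ⁻¹-cong = ⊖-cong }
          ; comm = λ f g → mk≈ (λ n → ℤP.+-comm (f n) (g n)) }
        ; *-cong = ⊛-cong
        ; *-assoc = ⊛-assoc
        ; *-identity = ⊛-identityˡ , ⊛-identityʳ
        ; distrib = ⊛-distribˡ-⊕ , ⊛-distribʳ-⊕ }
      ; *-comm = ⊛-comm } }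

  _·x^_ : ℤ → ℕ → Series
  (c ·x^ d) n = if d ℕ.≡ᵇ n then c else + 0

  x^_ : ℕ → Series
  x^ d = + 1 ·x^ d

  shift : ℕ → Series → Series
  shift zero    h         = h
  shift (suc d) h zero    = + 0
  shift (suc d) h (suc n) = shift d h n

  ·x^-⊛ : ∀ c d h → c ·x^ d ⊛ h ≈ scale c (shift d h)
  ·x^-⊛ c d h = mk≈ (go d)
    where
    go : ∀ d n → (c ·x^ d ⊛ h) n ≡ c ℤ.* shift d h n
    go zero    zero    = ℤP.+-identityʳ _
    go zero    (suc n) = trans (cong (ℤ._+_ (c ℤ.* h (suc n))) (∑-zero (suc n) (λ _ → refl))) (ℤP.+-identityʳ _)
    go (suc d) zero    = sym (ℤP.*-zeroʳ c)
    go (suc d) (suc n) = trans (ℤP.+-identityˡ _) (go d n)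

  ·x^-below : ∀ c {d n} → n < d → (c ·x^ d) n ≡ + 0
  ·x^-below c {suc d} {zero}  _         = refl
  ·x^-below c {suc d} {suc n} (s≤s n<d) = ·x^-below c n<d

  ·x^-cong : ∀ {s t a b} → s ≡ t → a ≡ b → s ·x^ a ≈ t ·x^ b
  ·x^-cong refl refl = ≈-refl

  scale-·x^ : ∀ s t d → scale s (t ·x^ d) ≈ (s ℤ.* t) ·x^ d
  scale-·x^ s t d = mk≈ λ n → by-cases (d ℕ.≡ᵇ n)
    where by-cases : ∀ b → s ℤ.* (if b then t else + 0) ≡ (if b then s ℤ.* t else + 0)
          by-cases true  = refl
          by-cases false = ℤP.*-zeroʳ s

  shift-·x^ : ∀ a t b → shift a (t ·x^ b) ≈ t ·x^ (a ℕ.+ b)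
  shift-·x^ a t b = mk≈ (go a)
    where
    go : ∀ a n → shift a (t ·x^ b) n ≡ (t ·x^ (a ℕ.+ b)) n
    go zero    n       = refl
    go (suc a) zero    = refl
    go (suc a) (suc n) = go a n

  ·x^-⊛-·x^ : ∀ s a t b → s ·x^ a ⊛ t ·x^ b ≈ (s ℤ.* t) ·x^ (a ℕ.+ b)
  ·x^-⊛-·x^ s a t b = ≈-trans (·x^-⊛ s a (t ·x^ b))
                        (≈-trans (mk≈ (λ n → cong (s ℤ.*_) (coeff (shift-·x^ a t b) n)))
                                 (scale-·x^ s t (a ℕ.+ b)))

  neg-·x^ : ∀ d → (- + 1) ·x^ d ≈ ⊖ x^ d
  neg-·x^ d = mk≈ λ n → by-cases (d ℕ.≡ᵇ n)
    where by-cases : ∀ b → (if b then - + 1 else + 0) ≡ - (if b then + 1 else + 0)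
          by-cases true  = refl
          by-cases false = refl

  zero-·x^ : ∀ d → + 0 ·x^ d ≈ 𝟘
  zero-·x^ d = mk≈ λ n → by-cases (d ℕ.≡ᵇ n)
    where by-cases : ∀ b → (if b then + 0 else + 0) ≡ + 0
          by-cases true  = refl
          by-cases false = refl

  neg-x^ : ∀ {c e d} → c ≡ - + 1 → e ≡ d → c ·x^ e ≈ ⊖ x^ d
  neg-x^ {e = e} refl refl = neg-·x^ e

  infix 4 _≈[<_]_
  record _≈[<_]_ (f : Series) (m : ℕ) (g : Series) : Set where
    constructor mk≈<
    field below : ∀ n → n < m → f n ≡ g n
  open _≈[<_]_ public

  ≈⇒≈< : ∀ {f g} m → f ≈ g → f ≈[< m ] g
  ≈⇒≈< m f≈g = mk≈< (λ n _ → coeff f≈g n)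

  ≈<-refl : ∀ {f m} → f ≈[< m ] f
  ≈<-refl = mk≈< (λ _ _ → refl)

  ≈<-sym : ∀ {f g m} → f ≈[< m ] g → g ≈[< m ] f
  ≈<-sym f≈g = mk≈< (λ n n<m → sym (below f≈g n n<m))

  ≈<-trans : ∀ {f g h m} → f ≈[< m ] g → g ≈[< m ] h → f ≈[< m ] h
  ≈<-trans f≈g g≈h = mk≈< (λ n n<m → trans (below f≈g n n<m) (below g≈h n n<m))

  ≈<-setoid : ℕ → Setoid 0ℓ 0ℓ
  ≈<-setoid m = record
    { Carrier = Series ; _≈_ = _≈[< m ]_
    ; isEquivalence = record { refl = ≈<-refl ; sym = ≈<-sym ; trans = ≈<-trans } }

  module ≈<-Reasoning (m : ℕ) = Relation.Binary.Reasoning.Setoid (≈<-setoid m)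

  ≈<-weaken : ∀ {f g m m′} → m′ ≤ m → f ≈[< m ] g → f ≈[< m′ ] g
  ≈<-weaken m′≤m f≈g = mk≈< (λ n n<m′ → below f≈g n (ℕP.<-≤-trans n<m′ m′≤m))

  ≈-from-≈< : ∀ {f g} → (∀ N → f ≈[< N ] g) → f ≈ g
  ≈-from-≈< f≈g = mk≈ (λ n → below (f≈g (suc n)) n (ℕP.n<1+n n))

  ⊕-cong-≈< : ∀ {f f′ g g′ m} → f ≈[< m ] f′ → g ≈[< m ] g′ → f ⊕ g ≈[< m ] f′ ⊕ g′
  ⊕-cong-≈< f≈f′ g≈g′ = mk≈< (λ n n<m → cong₂ ℤ._+_ (below f≈f′ n n<m) (below g≈g′ n n<m))

  ⊛-congʳ-≈< : ∀ {f f′ m} g → f ≈[< m ] f′ → f ⊛ g ≈[< m ] f′ ⊛ g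
  ⊛-congʳ-≈< g f≈f′ = mk≈< λ n n<m →
    ∑-cong-< (suc n) (λ k k≤n → cong (ℤ._* g (n ∸ k)) (below f≈f′ k (ℕP.<-≤-trans k≤n n<m)))

  ⊛-congˡ-≈< : ∀ {g g′ m} f → g ≈[< m ] g′ → f ⊛ g ≈[< m ] f ⊛ g′
  ⊛-congˡ-≈< {g} {g′} {m} f g≈g′ = begin
    f ⊛ g    ≈⟨ ≈⇒≈< m (⊛-comm f g) ⟩
    g ⊛ f    ≈⟨ ⊛-congʳ-≈< f g≈g′ ⟩
    g′ ⊛ f   ≈⟨ ≈⇒≈< m (⊛-comm g′ f) ⟩
    f ⊛ g′   ∎
    where open ≈<-Reasoning m

  ⊛-cong-≈< : ∀ {f f′ g g′ m} → f ≈[< m ] f′ → g ≈[< m ] g′ → f ⊛ g ≈[< m ] f′ ⊛ g′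
  ⊛-cong-≈< {f′ = f′} {g} f≈f′ g≈g′ = ≈<-trans (⊛-congʳ-≈< g f≈f′) (⊛-congˡ-≈< f′ g≈g′)

  ≈<-by-difference : ∀ {f g m} → f ⊕ ⊖ g ≈[< m ] 𝟘 → f ≈[< m ] g
  ≈<-by-difference {f} {g} f-g≈0 = mk≈< λ n n<m →
    trans (sym (ℤP.+-identityʳ (f n)))
          (trans (cong (ℤ._+_ (f n)) (sym (ℤP.+-inverseˡ (g n))))
                 (trans (sym (ℤP.+-assoc (f n) (- g n) (g n)))
                        (trans (cong (ℤ._+ g n) (below f-g≈0 n n<m)) (ℤP.+-identityˡ (g n)))))

  difference-≈< : ∀ {f g m} → f ≈[< m ] g → f ⊕ ⊖ g ≈[< m ] 𝟘
  difference-≈< {f} {g} f≈g = mk≈< λ n n<m →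
    trans (cong (ℤ._+ - g n) (below f≈g n n<m)) (ℤP.+-inverseʳ (g n))

  shift-≈<𝟘 : ∀ d {h r} → h ≈[< r ] 𝟘 → shift d h ≈[< d ℕ.+ r ] 𝟘
  shift-≈<𝟘 d {h} {r} h≈0 = mk≈< (go d)
    where
    go : ∀ d n → n < d ℕ.+ r → shift d h n ≡ + 0
    go zero    n       n<r         = below h≈0 n n<r
    go (suc d) zero    _           = refl
    go (suc d) (suc n) (s≤s n<d+r) = go d n n<d+r

  x^-⊛-≈<𝟘 : ∀ d W {D r} → D ≈[< r ] 𝟘 → x^ d ⊛ W ⊛ D ≈[< d ℕ.+ r ] 𝟘
  x^-⊛-≈<𝟘 d W {D} {r} D≈0 = begin
    x^ d ⊛ W ⊛ D
      ≈⟨ ≈⇒≈< (d ℕ.+ r) (≈-trans (⊛-assoc (x^ d) W D) (·x^-⊛ (+ 1) d (W ⊛ D))) ⟩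
    scale (+ 1) (shift d (W ⊛ D))
      ≈⟨ mk≈< (λ n n<d+r → trans (ℤP.*-identityˡ _) (below (shift-≈<𝟘 d W⊛D≈0) n n<d+r)) ⟩
    𝟘
      ∎
    where
    open ≈<-Reasoning (d ℕ.+ r)
    W⊛D≈0 : W ⊛ D ≈[< r ] 𝟘
    W⊛D≈0 = mk≈< λ n n<r → trans (below (⊛-congˡ-≈< W D≈0) n n<r) (∑-zero (suc n) (λ k → ℤP.*-zeroʳ (W k)))

  ≈<𝟘-extend : ∀ {D n} → D ≈[< n ] 𝟘 → D n ≡ + 0 → D ≈[< suc n ] 𝟘
  ≈<𝟘-extend {n = n} D≈0 Dn≡0 = mk≈< λ k k≤n → case ℕP.m≤n⇒m<n∨m≡n (ℕP.≤-pred k≤n) of λ where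
    (inj₁ k<n) → below D≈0 k k<n
    (inj₂ refl) → Dn≡0

  unit-cancel : ∀ {U D m} → U 0 ≡ + 1 → U ⊛ D ≈[< m ] 𝟘 → D ≈[< m ] 𝟘
  unit-cancel {U} {D} {m} U0≡1 UD≈0 = go m ℕP.≤-refl
    where
    go : ∀ n → n ≤ m → D ≈[< n ] 𝟘
    go zero    _     = mk≈< (λ _ ())
    go (suc n) n<m   = ≈<𝟘-extend D≈0 (begin
      D n                                                      ≡⟨ ℤP.*-identityˡ (D n) ⟨
      + 1 ℤ.* D n                                              ≡⟨ cong (ℤ._* D n) U0≡1 ⟨
      U 0 ℤ.* D n                                              ≡⟨ ℤP.+-identityʳ _ ⟨
      U 0 ℤ.* D n ℤ.+ + 0                                      ≡⟨ cong (ℤ._+_ (U 0 ℤ.* D n)) tail≡0 ⟨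
      U 0 ℤ.* D n ℤ.+ ∑ n (λ k → U (suc k) ℤ.* D (n ∸ suc k))  ≡⟨ below UD≈0 n n<m ⟩
      + 0                                                      ∎)
      where
      open ≡.≡-Reasoning
      D≈0 = go n (ℕP.<⇒≤ n<m)
      tail≡0 : ∑ n (λ k → U (suc k) ℤ.* D (n ∸ suc k)) ≡ + 0
      tail≡0 = trans (∑-cong-< n {g = λ _ → + 0} (λ k k<n →
                       trans (cong (U (suc k) ℤ.*_) (below D≈0 (n ∸ suc k) (ℕP.∸-monoʳ-< (s≤s z≤n) k<n)))
                             (ℤP.*-zeroʳ (U (suc k)))))
                     (∑-zero n (λ _ → refl))

  x^-≈<𝟘 : ∀ d → x^ d ≈[< d ] 𝟘
  x^-≈<𝟘 d = mk≈< (λ n n<d → ·x^-below (+ 1) n<d)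

  ⊖-≈<𝟘 : ∀ {g m} → g ≈[< m ] 𝟘 → ⊖ g ≈[< m ] 𝟘
  ⊖-≈<𝟘 g≈0 = mk≈< (λ n n<m → cong -_ (below g≈0 n n<m))

  𝟙⊕-≈< : ∀ {g m} → g ≈[< m ] 𝟘 → 𝟙 ⊕ g ≈[< m ] 𝟙
  𝟙⊕-≈< g≈0 = mk≈< (λ n n<m → trans (cong (ℤ._+_ (𝟙 n)) (below g≈0 n n<m)) (ℤP.+-identityʳ (𝟙 n)))

  ∏ : (ℕ → Series) → ℕ → Series
  ∏ f zero    = 𝟙
  ∏ f (suc M) = ∏ f M ⊛ f (suc M)

  products-stabilise : ∀ (P f : ℕ → Series) → (∀ b → P (suc b) ≈ P b ⊛ f (suc b)) →
                       (∀ j → f (suc j) ≈[< suc j ] 𝟙) → ∀ {a b} → a ≤ b → P b ≈[< suc a ] P a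
  products-stabilise P f step f≈1 {a} {b} a≤b with ℕP.m≤n⇒m<n∨m≡n a≤b
  ... | inj₂ refl = ≈<-refl
  ... | inj₁ a<b with b
  ...   | suc b′ = begin
    P (suc b′)         ≈⟨ ≈⇒≈< (suc a) (step b′) ⟩
    P b′ ⊛ f (suc b′)  ≈⟨ ⊛-congˡ-≈< (P b′) (≈<-weaken a<b (f≈1 b′)) ⟩
    P b′ ⊛ 𝟙           ≈⟨ ≈⇒≈< (suc a) (≈-trans (⊛-comm (P b′) 𝟙) (⊛-identityˡ (P b′))) ⟩
    P b′               ≈⟨ products-stabilise P f step f≈1 (ℕP.≤-pred a<b) ⟩
    P a                ∎
    where open ≈<-Reasoning (suc a)

  ∏-stabilise : ∀ f → (∀ j → f (suc j) ≈[< suc j ] 𝟙) → ∀ {a b} → a ≤ b → ∏ f b ≈[< suc a ] ∏ f a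
  ∏-stabilise f = products-stabilise (∏ f) f (λ _ → ≈-refl)

  ∏-constant : ∀ f → (∀ j → f (suc j) ≈[< suc j ] 𝟙) → ∀ M → ∏ f M 0 ≡ + 1
  ∏-constant f f≈1 M = below (∏-stabilise f f≈1 {b = M} z≤n) 0 (s≤s z≤n)

module SeriesAlgebra where

  open PowerSeries
  open CommutativeRing ℤ⟦x⟧ using (commutativeSemiring; setoid)
  module ≈-Reasoning = Relation.Binary.Reasoning.Setoid setoid
  open import Algebra.Properties.CommutativeSemiring.Exp commutativeSemiring public
    using () renaming (_^_ to _⊛^_; ^-distrib-* to ⊛^-distrib-⊛; ^-congˡ to ⊛^-cong)
  open FiniteSums ℤ⟦x⟧ public
    using () renaming (∑ to ∑ˢ; ∑-cong to ∑ˢ-cong; *-distribʳ-∑ to ⊛-distribʳ-∑ˢ)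
  open IntegerSolver ℤ⟦x⟧ public using (solve; _:=_; _:+_; _:*_; _:-_; con; Polynomial)

  :1 : ∀ {n} → Polynomial n
  :1 = con (+ 1)

  ·x^-⊛^ : ∀ c d k → (c ·x^ d) ⊛^ k ≈ (c ℤ.^ k) ·x^ (k ℕ.* d)
  ·x^-⊛^ c d zero    = mk≈ λ where
    zero    → refl
    (suc n) → refl
  ·x^-⊛^ c d (suc k) = ≈-trans (⊛-cong (≈-refl {c ·x^ d}) (·x^-⊛^ c d k)) (·x^-⊛-·x^ c d (c ℤ.^ k) (k ℕ.* d))

  ∑ˢ-coeff : ∀ L (F : ℕ → Series) n → ∑ˢ L F n ≡ ∑ L (λ i → F i n)
  ∑ˢ-coeff zero    F n = refl
  ∑ˢ-coeff (suc L) F n = cong (ℤ._+_ (F 0 n)) (∑ˢ-coeff L (λ i → F (suc i)) n)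

  ∑ˢ-cong-≈< : ∀ L {F G : ℕ → Series} {m} → (∀ i → i < L → F i ≈[< m ] G i) → ∑ˢ L F ≈[< m ] ∑ˢ L G
  ∑ˢ-cong-≈< zero    F≈G = ≈<-refl
  ∑ˢ-cong-≈< (suc L) F≈G = ⊕-cong-≈< (F≈G 0 (s≤s z≤n)) (∑ˢ-cong-≈< L (λ i i<L → F≈G (suc i) (s≤s i<L)))

module JacobiLimit (A′ B : PowerSeries.Series) where

  open PowerSeries
  open SeriesAlgebra
  open JacobiExponents
  open import Data.Product using (_,_)

  A : Series
  A = x^ 1 ⊛ A′

  open FiniteJacobi.Jacobi ℤ⟦x⟧ A B public

  A⊛^ : ∀ e → A ⊛^ e ≈ x^ e ⊛ A′ ⊛^ e
  A⊛^ e = ≈-trans (⊛^-distrib-⊛ (x^ 1) A′ e)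
                  (⊛-cong (≈-trans (·x^-⊛^ (+ 1) 1 e) (·x^-cong (ℤP.^-zeroˡ e) (ℕP.*-identityʳ e))) ≈-refl)

  monomial-x^ : ∀ i N → monomial i N ≈ x^ expA i N ⊛ (A′ ⊛^ expA i N ⊛ B ⊛^ expB i N)
  monomial-x^ i N = ≈-trans (⊛-cong (A⊛^ (expA i N)) ≈-refl) (⊛-assoc (x^ expA i N) _ _)

  y⊛^-≈<𝟘 : ∀ j → y ⊛^ j ≈[< j ] 𝟘
  y⊛^-≈<𝟘 j = ≈<-weaken (ℕP.≤-reflexive (sym (ℕP.+-identityʳ j))) (begin
    y ⊛^ j                            ≈⟨ ≈⇒≈< (j ℕ.+ 0) (≈-trans (⊛^-distrib-⊛ A B j) (⊛-cong (A⊛^ j) ≈-refl)) ⟩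
    x^ j ⊛ A′ ⊛^ j ⊛ B ⊛^ j           ≈⟨ x^-⊛-≈<𝟘 j (A′ ⊛^ j) (mk≈< (λ _ ())) ⟩
    𝟘                                 ∎)
    where open ≈<-Reasoning (j ℕ.+ 0)

  poch-stabilise : ∀ {a b} → a ≤ b → poch b ≈[< suc a ] poch a
  poch-stabilise = products-stabilise poch (λ j → 𝟙 ⊕ ⊖ y ⊛^ j) (λ _ → ≈-refl)
                     (λ j → 𝟙⊕-≈< (⊖-≈<𝟘 (y⊛^-≈<𝟘 (suc j))))

  poch-constant : ∀ N → poch N 0 ≡ + 1
  poch-constant N = below (poch-stabilise {b = N} z≤n) 0 (s≤s z≤n)

  module _ (N : ℕ) where

    M : ℕ
    M = N ℕ.+ N

    gauss-poch-≈< : ∀ i j k → i ℕ.+ j ≡ M → k ≤ i → k ≤ j → k ≤ N →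
                    gauss M i ⊛ poch N ⊛ poch N ≈[< suc k ] poch N
    gauss-poch-≈< i j k i+j≡M k≤i k≤j k≤N = begin
      gauss M i ⊛ poch N ⊛ poch N    ≈⟨ ⊛-cong-≈< (⊛-congˡ-≈< (gauss M i) (toward k≤N k≤i)) (toward k≤N k≤j) ⟩
      gauss M i ⊛ poch i ⊛ poch j    ≡⟨ cong (λ m → gauss m i ⊛ poch i ⊛ poch j) (sym i+j≡M) ⟩
      gauss (i ℕ.+ j) i ⊛ poch i ⊛ poch j ≈⟨ ≈⇒≈< (suc k) (gauss-poch i j) ⟩
      poch (i ℕ.+ j)                 ≡⟨ cong poch i+j≡M ⟩
      poch M                         ≈⟨ toward k≤N (ℕP.≤-trans k≤N (ℕP.m≤m+n N N)) ⟨
      poch N                         ∎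
      where
      open ≈<-Reasoning (suc k)
      toward : ∀ {a b} → k ≤ a → k ≤ b → poch a ≈[< suc k ] poch b
      toward k≤a k≤b = ≈<-trans (poch-stabilise k≤a) (≈<-sym (poch-stabilise k≤b))

    monomial-gauss-≈< : ∀ i → i < suc M →
                        monomial i N ⊛ (gauss M i ⊛ poch N ⊛ poch N) ≈[< N ] monomial i N ⊛ poch N
    monomial-gauss-≈< i (s≤s i≤M) with expA-depth i (M ∸ i) N (ℕP.m+[n∸m]≡n i≤M)
    ... | k , k≤i , k≤j , k≤N , N≤expA+1+k = ≈<-by-difference (begin
      m ⊛ G ⊕ ⊖ (m ⊛ P)             ≈⟨ ≈⇒≈< N (solve 3 (λ m a b → m :* a :- m :* b := m :* (a :- b)) ≈-refl m G P) ⟩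
      m ⊛ (G ⊕ ⊖ P)                 ≈⟨ ≈⇒≈< N (⊛-cong (monomial-x^ i N) ≈-refl) ⟩
      x^ expA i N ⊛ W ⊛ (G ⊕ ⊖ P)   ≈⟨ ≈<-weaken N≤expA+1+k (x^-⊛-≈<𝟘 (expA i N) W (difference-≈< G≈P)) ⟩
      𝟘                             ∎)
      where
      open ≈<-Reasoning N
      m = monomial i N
      G = gauss M i ⊛ poch N ⊛ poch N
      P = poch N
      W = A′ ⊛^ expA i N ⊛ B ⊛^ expB i N
      G≈P = gauss-poch-≈< i (M ∸ i) k (ℕP.m+[n∸m]≡n i≤M) k≤i k≤j k≤N

    jacobiSum : Series
    jacobiSum = ∑ˢ (suc M) (λ i → monomial i N)

    product-limit : product N ⊛ poch N ≈[< N ] jacobiSum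
    product-limit = ≈<-by-difference (unit-cancel {U = poch N} (poch-constant N) (begin
      P ⊛ (product N ⊛ P ⊕ ⊖ jacobiSum)      ≈⟨ ≈⇒≈< N (solve 3 (λ e p s → e :* (p :* e :- s) := p :* e :* e :- s :* e)
                                                               ≈-refl P (product N) jacobiSum) ⟩
      product N ⊛ P ⊛ P ⊕ ⊖ (jacobiSum ⊛ P)  ≈⟨ difference-≈< squared ⟩
      𝟘                                      ∎))
      where
      open ≈<-Reasoning N
      P = poch N
      squared : product N ⊛ P ⊛ P ≈[< N ] jacobiSum ⊛ P
      squared = begin
        product N ⊛ P ⊛ P
          ≈⟨ ≈⇒≈< N (⊛-cong (⊛-cong (finite-jacobi N) ≈-refl) ≈-refl) ⟩
        expansion N ⊛ P ⊛ P
          ≈⟨ ≈⇒≈< N spread ⟩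
        ∑ˢ (suc M) (λ i → monomial i N ⊛ (gauss M i ⊛ P ⊛ P))
          ≈⟨ ∑ˢ-cong-≈< (suc M) monomial-gauss-≈< ⟩
        ∑ˢ (suc M) (λ i → monomial i N ⊛ P)
          ≈⟨ ≈⇒≈< N (⊛-distribʳ-∑ˢ (suc M) (λ i → monomial i N) P) ⟩
        jacobiSum ⊛ P
          ∎
        where
        spread : expansion N ⊛ P ⊛ P ≈ ∑ˢ (suc M) (λ i → monomial i N ⊛ (gauss M i ⊛ P ⊛ P))
        spread = ≈-trans (⊛-cong (≈-sym (⊛-distribʳ-∑ˢ (suc M) (λ i → monomial i N ⊛ gauss M i) P)) ≈-refl)
                 (≈-trans (≈-sym (⊛-distribʳ-∑ˢ (suc M) (λ i → monomial i N ⊛ gauss M i ⊛ P) P))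
                 (∑ˢ-cong (suc M) (λ i → solve 3 (λ m g p → m :* g :* p :* p := m :* (g :* p :* p))
                                                 ≈-refl (monomial i N) (gauss M i) P)))

module Signs where

  open import Defs using (sgn)
  open import Data.Integer.Tactic.RingSolver using (solve-∀)

  sgn-+ : ∀ a b → sgn (a ℕ.+ b) ≡ sgn a ℤ.* sgn b
  sgn-+ zero    b = sym (ℤP.*-identityˡ (sgn b))
  sgn-+ (suc a) b = trans (cong -_ (sgn-+ a b)) (ℤP.neg-distribˡ-* (sgn a) (sgn b))

  sgn-*-sgn : ∀ k → sgn k ℤ.* sgn k ≡ + 1
  sgn-*-sgn zero    = refl
  sgn-*-sgn (suc k) = trans (neg-square (sgn k)) (sgn-*-sgn k)
    where neg-square : ∀ a → - a ℤ.* - a ≡ a ℤ.* a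
          neg-square = solve-∀

  sgn-even : ∀ k → sgn (k ℕ.+ k) ≡ + 1
  sgn-even k = trans (sgn-+ k k) (sgn-*-sgn k)

  sgn-odd : ∀ k → sgn (suc (k ℕ.+ k)) ≡ ℤ.-1ℤ
  sgn-odd k = cong -_ (sgn-even k)

  sgn-square : ∀ k → sgn (k ℕ.* k) ≡ sgn k
  sgn-square zero    = refl
  sgn-square (suc k) = cong -_ (begin
    sgn (k ℕ.+ k ℕ.* suc k)           ≡⟨ sgn-+ k (k ℕ.* suc k) ⟩
    sgn k ℤ.* sgn (k ℕ.* suc k)       ≡⟨ cong (λ m → sgn k ℤ.* sgn m) (ℕP.*-suc k k) ⟩
    sgn k ℤ.* sgn (k ℕ.+ k ℕ.* k)     ≡⟨ cong (sgn k ℤ.*_) (sgn-+ k (k ℕ.* k)) ⟩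
    sgn k ℤ.* (sgn k ℤ.* sgn (k ℕ.* k)) ≡⟨ cong (λ z → sgn k ℤ.* (sgn k ℤ.* z)) (sgn-square k) ⟩
    sgn k ℤ.* (sgn k ℤ.* sgn k)       ≡⟨ cong (sgn k ℤ.*_) (sgn-*-sgn k) ⟩
    sgn k ℤ.* + 1                     ≡⟨ ℤP.*-identityʳ (sgn k) ⟩
    sgn k                             ∎)
    where open ≡.≡-Reasoning

  -1^≡sgn : ∀ k → ℤ.-1ℤ ℤ.^ k ≡ sgn k
  -1^≡sgn zero    = refl
  -1^≡sgn (suc k) = trans (ℤP.-1*i≡-i _) (cong -_ (-1^≡sgn k))

  -1^-*-1^ : ∀ p q → ℤ.-1ℤ ℤ.^ p ℤ.* ℤ.-1ℤ ℤ.^ q ≡ sgn (p ℕ.+ q)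
  -1^-*-1^ p q = trans (cong₂ ℤ._*_ (-1^≡sgn p) (-1^≡sgn q)) (sym (sgn-+ p q))

  -1^-*-1^-odd : ∀ k → ℤ.-1ℤ ℤ.^ suc k ℤ.* ℤ.-1ℤ ℤ.^ k ≡ ℤ.-1ℤ
  -1^-*-1^-odd k = trans (-1^-*-1^ (suc k) k) (sgn-odd k)

  -1^-*-1^-odd′ : ∀ k → ℤ.-1ℤ ℤ.^ k ℤ.* ℤ.-1ℤ ℤ.^ suc k ≡ ℤ.-1ℤ
  -1^-*-1^-odd′ k = trans (-1^-*-1^ k (suc k)) (trans (cong sgn (ℕP.+-suc k k)) (sgn-odd k))

  -1^-*-1^-even : ∀ k → ℤ.-1ℤ ℤ.^ k ℤ.* ℤ.-1ℤ ℤ.^ k ≡ + 1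
  -1^-*-1^-even k = trans (-1^-*-1^ k k) (sgn-even k)

-- The triple product with A = s x^(a+1) and B = t x^b.
module MonomialJacobi (s : ℤ) (a : ℕ) (t : ℤ) (b : ℕ) where

  open PowerSeries
  open SeriesAlgebra
  open JacobiExponents
  open JacobiLimit (s ·x^ a) (t ·x^ b) public

  sign : ℕ → ℕ → ℤ
  sign p q = s ℤ.^ p ℤ.* t ℤ.^ q

  degree : ℕ → ℕ → ℕ
  degree p q = p ℕ.* suc a ℕ.+ q ℕ.* b

  A⊛^-⊛-B⊛^ : ∀ p q → A ⊛^ p ⊛ (t ·x^ b) ⊛^ q ≈ sign p q ·x^ degree p q
  A⊛^-⊛-B⊛^ p q = ≈-trans (⊛-cong A⊛^p (·x^-⊛^ t b q)) (·x^-⊛-·x^ (s ℤ.^ p) (p ℕ.* suc a) (t ℤ.^ q) (q ℕ.* b))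
    where
    A⊛^p : A ⊛^ p ≈ (s ℤ.^ p) ·x^ (p ℕ.* suc a)
    A⊛^p = ≈-trans (⊛^-cong p (·x^-⊛-·x^ (+ 1) 1 s a))
                   (≈-trans (·x^-⊛^ (+ 1 ℤ.* s) (suc a) p)
                            (·x^-cong {a = p ℕ.* suc a} (cong (ℤ._^ p) (ℤP.*-identityˡ s)) refl))

  monomial-·x^ : ∀ i N → monomial i N ≈ sign (expA i N) (expB i N) ·x^ degree (expA i N) (expB i N)
  monomial-·x^ i N = A⊛^-⊛-B⊛^ (expA i N) (expB i N)

  X-·x^ : ∀ N → X N ≈ sign (suc N) N ·x^ degree (suc N) N
  X-·x^ N = A⊛^-⊛-B⊛^ (suc N) N

  Z-·x^ : ∀ N → Z N ≈ sign N (suc N) ·x^ degree N (suc N)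
  Z-·x^ N = A⊛^-⊛-B⊛^ N (suc N)

  y⊛^-·x^ : ∀ k → y ⊛^ k ≈ sign k k ·x^ degree k k
  y⊛^-·x^ k = ≈-trans (⊛^-distrib-⊛ A (t ·x^ b) k) (A⊛^-⊛-B⊛^ k k)

  product-poch-step : ∀ N {X′ Z′ Y′} → X N ≈ X′ → Z N ≈ Z′ → y ⊛^ suc N ≈ Y′ →
    product (suc N) ⊛ poch (suc N) ≈ product N ⊛ poch N ⊛ ((𝟙 ⊕ X′) ⊛ (𝟙 ⊕ Z′) ⊛ (𝟙 ⊕ ⊖ Y′))
  product-poch-step N X≈ Z≈ y≈ = ≈-trans (product-poch-suc N) (⊛-congˡ (product N ⊛ poch N)
    (⊛-cong (⊛-cong (⊕-congˡ 𝟙 X≈) (⊕-congˡ 𝟙 Z≈)) (⊕-congˡ 𝟙 (⊖-cong y≈))))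

  term : ℕ → ℕ → ℕ → ℤ
  term n p q = (sign p q ·x^ degree p q) n

  jacobiSum-coeff : ∀ N n → jacobiSum N n ≡
    ∑ N (λ K → term n (tri K) (tri (suc K))) ℤ.+ ∑ (suc N) (λ k → term n (tri k) (tri (k ∸ 1)))
  jacobiSum-coeff N n = begin
    jacobiSum N n
      ≡⟨ ∑ˢ-coeff (suc (N ℕ.+ N)) (λ i → monomial i N) n ⟩
    ∑ (suc (N ℕ.+ N)) (λ i → monomial i N n)
      ≡⟨ ∑-cong (suc (N ℕ.+ N)) (λ i → coeff (monomial-·x^ i N) n) ⟩
    ∑ (suc (N ℕ.+ N)) F
      ≡⟨ cong (λ m → ∑ m F) (ℕP.+-suc N N) ⟨
    ∑ (N ℕ.+ suc N) F
      ≡⟨ ℤ-Sums.∑-split N (suc N) F ⟩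
    ∑ N F ℤ.+ ∑ (suc N) (λ k → F (N ℕ.+ k))
      ≡⟨ cong₂ ℤ._+_ (trans (∑-cong-< N lower) (ℤ-Sums.∑-reverse N (λ K → term n (tri K) (tri (suc K)))))
                     (∑-cong (suc N) (λ k → cong₂ (term n) (expA-above N k) (expB-above N k))) ⟩
    ∑ N (λ K → term n (tri K) (tri (suc K))) ℤ.+ ∑ (suc N) (λ k → term n (tri k) (tri (k ∸ 1)))
      ∎
    where
    open ≡.≡-Reasoning
    F : ℕ → ℤ
    F i = term n (expA i N) (expB i N)
    lower : ∀ i → i < N → F i ≡ term n (tri (N ∸ suc i)) (tri (suc (N ∸ suc i)))
    lower i i<N = cong₂ (term n) (trans (cong (expA i) N≡) (expA-below i (N ∸ suc i)))
                                 (trans (cong (expB i) N≡) (expB-below i (N ∸ suc i)))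
      where N≡ : N ≡ i ℕ.+ suc (N ∸ suc i)
            N≡ = sym (trans (ℕP.+-suc i (N ∸ suc i)) (ℕP.m+[n∸m]≡n i<N))


module Products where

  open PowerSeries
  open SeriesAlgebra
  open import Data.Nat.Tactic.RingSolver using () renaming (solve-∀ to ℕ-solve-∀)

  eulerProd : ℕ → ℕ → Series
  eulerProd c = ∏ (λ j → 𝟙 ⊕ ⊖ x^ (j ℕ.* c))

  oddProd : ℕ → Series
  oddProd = ∏ (λ j → 𝟙 ⊕ ⊖ x^ (j ℕ.+ (j ∸ 1)))

  distinctProd : ℕ → Series
  distinctProd = ∏ (λ j → 𝟙 ⊕ x^ j)

  distinctProd₀ : ℕ → Series
  distinctProd₀ = ∏ (λ j → 𝟙 ⊕ x^ (j ∸ 1))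

  eulerProd-stabilise : ∀ c {a b} → a ≤ b → eulerProd (suc c) b ≈[< suc a ] eulerProd (suc c) a
  eulerProd-stabilise c = ∏-stabilise _ (λ j → ≈<-weaken (ℕP.m≤m*n (suc j) (suc c))
                                                   (𝟙⊕-≈< (⊖-≈<𝟘 (x^-≈<𝟘 (suc j ℕ.* suc c)))))

  distinctProd-stabilise : ∀ {a b} → a ≤ b → distinctProd b ≈[< suc a ] distinctProd a
  distinctProd-stabilise = ∏-stabilise _ (λ j → 𝟙⊕-≈< (x^-≈<𝟘 (suc j)))

  eulerProd-double : ∀ N → eulerProd 1 (N ℕ.+ N) ≈ oddProd N ⊛ eulerProd 2 N
  eulerProd-double zero    = ≈-sym (⊛-identityˡ 𝟙)
  eulerProd-double (suc N) = begin
    eulerProd 1 (suc N ℕ.+ suc N)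
      ≡⟨ cong (eulerProd 1) (cong suc (ℕP.+-suc N N)) ⟩
    eulerProd 1 (N ℕ.+ N) ⊛ (𝟙 ⊕ ⊖ x^ (suc (N ℕ.+ N) ℕ.* 1)) ⊛ (𝟙 ⊕ ⊖ x^ (suc (suc (N ℕ.+ N)) ℕ.* 1))
      ≈⟨ ⊛-cong (⊛-cong (eulerProd-double N) (≡⇒≈ (cong (λ d → 𝟙 ⊕ ⊖ x^ d) (odd N))))
                (≡⇒≈ (cong (λ d → 𝟙 ⊕ ⊖ x^ d) (even N))) ⟩
    oddProd N ⊛ eulerProd 2 N ⊛ (𝟙 ⊕ ⊖ x^ (suc N ℕ.+ N)) ⊛ (𝟙 ⊕ ⊖ x^ (suc N ℕ.* 2))
      ≈⟨ solve 4 (λ o e a b → o :* e :* (:1 :- a) :* (:1 :- b) := (o :* (:1 :- a)) :* (e :* (:1 :- b)))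
                 ≈-refl (oddProd N) (eulerProd 2 N) (x^ (suc N ℕ.+ N)) (x^ (suc N ℕ.* 2)) ⟩
    oddProd (suc N) ⊛ eulerProd 2 (suc N)
      ∎
    where
    open ≈-Reasoning
    odd : ∀ N → suc (N ℕ.+ N) ℕ.* 1 ≡ suc N ℕ.+ N
    odd = ℕ-solve-∀
    even : ∀ N → suc (suc (N ℕ.+ N)) ℕ.* 1 ≡ suc N ℕ.* 2
    even = ℕ-solve-∀

  distinct-euler : ∀ M → distinctProd M ⊛ eulerProd 1 M ≈ eulerProd 2 M
  distinct-euler zero    = ⊛-identityˡ 𝟙
  distinct-euler (suc M) = begin
    distinctProd M ⊛ (𝟙 ⊕ a) ⊛ (eulerProd 1 M ⊛ (𝟙 ⊕ ⊖ x^ (suc M ℕ.* 1)))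
      ≈⟨ ⊛-congˡ (distinctProd M ⊛ (𝟙 ⊕ a))
                 (⊛-congˡ (eulerProd 1 M) (≡⇒≈ (cong (λ d → 𝟙 ⊕ ⊖ x^ d) (ℕP.*-identityʳ (suc M))))) ⟩
    distinctProd M ⊛ (𝟙 ⊕ a) ⊛ (eulerProd 1 M ⊛ (𝟙 ⊕ ⊖ a))
      ≈⟨ solve 4 (λ q e a b → q :* (:1 :+ a) :* (e :* (:1 :- a)) := q :* e :* (:1 :- a :* a))
                 ≈-refl (distinctProd M) (eulerProd 1 M) a a ⟩
    distinctProd M ⊛ eulerProd 1 M ⊛ (𝟙 ⊕ ⊖ (a ⊛ a))
      ≈⟨ ⊛-cong (distinct-euler M) (⊕-congˡ 𝟙 (⊖-cong (≈-trans (·x^-⊛-·x^ (+ 1) (suc M) (+ 1) (suc M))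
                                                             (·x^-cong refl (twice M))))) ⟩
    eulerProd 2 (suc M)
      ∎
    where
    open ≈-Reasoning
    a = x^ suc M
    twice : ∀ M → suc M ℕ.+ suc M ≡ suc M ℕ.* 2
    twice = ℕ-solve-∀

  distinctProd₀-suc : ∀ K → distinctProd₀ (suc K) ≈ scale (+ 2) (distinctProd K)
  distinctProd₀-suc zero    = ≈-trans (⊛-identityˡ (𝟙 ⊕ x^ 0)) (mk≈ λ where
    zero    → refl
    (suc n) → refl)
  distinctProd₀-suc (suc K) =
    ≈-trans (⊛-cong (distinctProd₀-suc K) ≈-refl) (scale-⊛ (+ 2) (distinctProd K) (𝟙 ⊕ x^ suc K))

  distinct-odd : ∀ N → distinctProd (N ℕ.+ N) ⊛ oddProd N ≈[< suc N ] 𝟙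
  distinct-odd N = ≈<-by-difference (unit-cancel {U = eulerProd 2 N} (∏-constant _ factor≈1 N) (begin
    E ⊛ (D ⊛ O ⊕ ⊖ 𝟙)
      ≈⟨ ≈⇒≈< (suc N) (solve 3 (λ e d o → e :* (d :* o :- :1) := d :* (o :* e) :- e) ≈-refl E D O) ⟩
    D ⊛ (O ⊛ E) ⊕ ⊖ E
      ≈⟨ ≈⇒≈< (suc N) (⊕-congʳ (⊖ E) (≈-trans (⊛-congˡ D (≈-sym (eulerProd-double N))) (distinct-euler (N ℕ.+ N)))) ⟩
    eulerProd 2 (N ℕ.+ N) ⊕ ⊖ E
      ≈⟨ difference-≈< (eulerProd-stabilise 1 (ℕP.m≤m+n N N)) ⟩
    𝟘
      ∎))
    where
    open ≈<-Reasoning (suc N)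
    E = eulerProd 2 N ; D = distinctProd (N ℕ.+ N) ; O = oddProd N
    factor≈1 : ∀ j → 𝟙 ⊕ ⊖ x^ (suc j ℕ.* 2) ≈[< suc j ] 𝟙
    factor≈1 j = ≈<-weaken (ℕP.m≤m*n (suc j) 2) (𝟙⊕-≈< (⊖-≈<𝟘 (x^-≈<𝟘 (suc j ℕ.* 2))))

module Specialisations where

  open PowerSeries
  open SeriesAlgebra
  open Products
  open Signs
  open import Data.Nat.Tactic.RingSolver using () renaming (solve-∀ to ℕ-solve-∀)

  module Theta = MonomialJacobi ℤ.-1ℤ 0 ℤ.-1ℤ 1

  theta-regroup : ∀ N → Theta.product N ⊛ Theta.poch N ≈ oddProd N ⊛ oddProd N ⊛ eulerProd 2 N
  theta-regroup zero    = ≈-sym (⊛-identityʳ (𝟙 ⊛ 𝟙))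
  theta-regroup (suc N) = begin
    Theta.product (suc N) ⊛ Theta.poch (suc N)
      ≈⟨ Theta.product-poch-step N X≈ Z≈ y≈ ⟩
    Theta.product N ⊛ Theta.poch N ⊛ ((𝟙 ⊕ ⊖ x^ odd) ⊛ (𝟙 ⊕ ⊖ x^ odd) ⊛ (𝟙 ⊕ ⊖ x^ even))
      ≈⟨ ⊛-congʳ _ (theta-regroup N) ⟩
    oddProd N ⊛ oddProd N ⊛ eulerProd 2 N ⊛ ((𝟙 ⊕ ⊖ x^ odd) ⊛ (𝟙 ⊕ ⊖ x^ odd) ⊛ (𝟙 ⊕ ⊖ x^ even))
      ≈⟨ solve 4 (λ o e a b → (o :* o :* e) :* ((:1 :- a) :* (:1 :- a) :* (:1 :- b))
                                := (o :* (:1 :- a)) :* (o :* (:1 :- a)) :* (e :* (:1 :- b)))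
                 ≈-refl (oddProd N) (eulerProd 2 N) (x^ odd) (x^ even) ⟩
    oddProd (suc N) ⊛ oddProd (suc N) ⊛ eulerProd 2 (suc N)
      ∎
    where
    open ≈-Reasoning
    odd = suc N ℕ.+ N
    even = suc N ℕ.* 2
    X≈ : Theta.X N ≈ ⊖ x^ odd
    X≈ = ≈-trans (Theta.X-·x^ N) (neg-x^ (-1^-*-1^-odd N) (exponent N))
      where exponent : ∀ N → suc N ℕ.* 1 ℕ.+ N ℕ.* 1 ≡ suc N ℕ.+ N
            exponent = ℕ-solve-∀
    Z≈ : Theta.Z N ≈ ⊖ x^ odd
    Z≈ = ≈-trans (Theta.Z-·x^ N) (neg-x^ (-1^-*-1^-odd′ N) (exponent N))
      where exponent : ∀ N → N ℕ.* 1 ℕ.+ suc N ℕ.* 1 ≡ suc N ℕ.+ N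
            exponent = ℕ-solve-∀
    y≈ : Theta.y ⊛^ suc N ≈ x^ even
    y≈ = ≈-trans (Theta.y⊛^-·x^ (suc N)) (·x^-cong (-1^-*-1^-even (suc N)) (exponent N))
      where exponent : ∀ N → suc N ℕ.* 1 ℕ.+ suc N ℕ.* 1 ≡ suc N ℕ.* 2
            exponent = ℕ-solve-∀

  module Psi = MonomialJacobi (+ 1) 0 (+ 1) 0

  psi-regroup : ∀ N → Psi.product N ⊛ Psi.poch N ≈ distinctProd N ⊛ distinctProd₀ N ⊛ eulerProd 1 N
  psi-regroup zero    = ≈-sym (⊛-identityʳ (𝟙 ⊛ 𝟙))
  psi-regroup (suc N) = begin
    Psi.product (suc N) ⊛ Psi.poch (suc N)
      ≈⟨ Psi.product-poch-step N X≈ Z≈ y≈ ⟩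
    Psi.product N ⊛ Psi.poch N ⊛ ((𝟙 ⊕ x^ suc N) ⊛ (𝟙 ⊕ x^ N) ⊛ (𝟙 ⊕ ⊖ x^ (suc N ℕ.* 1)))
      ≈⟨ ⊛-congʳ _ (psi-regroup N) ⟩
    D ⊛ D₀ ⊛ E ⊛ ((𝟙 ⊕ x^ suc N) ⊛ (𝟙 ⊕ x^ N) ⊛ (𝟙 ⊕ ⊖ x^ (suc N ℕ.* 1)))
      ≈⟨ solve 6 (λ d d₀ e a b c → (d :* d₀ :* e) :* ((:1 :+ a) :* (:1 :+ b) :* (:1 :- c))
                                   := (d :* (:1 :+ a)) :* (d₀ :* (:1 :+ b)) :* (e :* (:1 :- c)))
                 ≈-refl D D₀ E (x^ suc N) (x^ N) (x^ (suc N ℕ.* 1)) ⟩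
    distinctProd (suc N) ⊛ distinctProd₀ (suc N) ⊛ eulerProd 1 (suc N)
      ∎
    where
    open ≈-Reasoning
    D = distinctProd N ; D₀ = distinctProd₀ N ; E = eulerProd 1 N
    1^-*-1^ : ∀ p q → (+ 1) ℤ.^ p ℤ.* (+ 1) ℤ.^ q ≡ + 1
    1^-*-1^ p q = cong₂ ℤ._*_ (ℤP.^-zeroˡ p) (ℤP.^-zeroˡ q)
    X≈ : Psi.X N ≈ x^ suc N
    X≈ = ≈-trans (Psi.X-·x^ N) (·x^-cong (1^-*-1^ (suc N) N) (exponent N))
      where exponent : ∀ N → suc N ℕ.* 1 ℕ.+ N ℕ.* 0 ≡ suc N
            exponent = ℕ-solve-∀
    Z≈ : Psi.Z N ≈ x^ N
    Z≈ = ≈-trans (Psi.Z-·x^ N) (·x^-cong (1^-*-1^ N (suc N)) (exponent N))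
      where exponent : ∀ N → N ℕ.* 1 ℕ.+ suc N ℕ.* 0 ≡ N
            exponent = ℕ-solve-∀
    y≈ : Psi.y ⊛^ suc N ≈ x^ (suc N ℕ.* 1)
    y≈ = ≈-trans (Psi.y⊛^-·x^ (suc N)) (·x^-cong (1^-*-1^ (suc N) (suc N)) (exponent N))
      where exponent : ∀ N → suc N ℕ.* 1 ℕ.+ suc N ℕ.* 0 ≡ suc N ℕ.* 1
            exponent = ℕ-solve-∀

  module Pentagonal (c′ : ℕ) = MonomialJacobi ℤ.-1ℤ (c′ ℕ.+ suc c′) ℤ.-1ℤ (suc c′)

  pentagonal-regroup : ∀ c′ N → Pentagonal.product c′ N ⊛ Pentagonal.poch c′ N ≈ eulerProd (suc c′) (N ℕ.* 3)
  pentagonal-regroup c′ zero    = ⊛-identityˡ 𝟙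
  pentagonal-regroup c′ (suc N) = begin
    product (suc N) ⊛ poch (suc N)
      ≈⟨ product-poch-step N X≈ Z≈ y≈ ⟩
    product N ⊛ poch N ⊛ ((𝟙 ⊕ ⊖ x^ (e₂ ℕ.* c)) ⊛ (𝟙 ⊕ ⊖ x^ (e₁ ℕ.* c)) ⊛ (𝟙 ⊕ ⊖ x^ (e₃ ℕ.* c)))
      ≈⟨ ⊛-congʳ _ (pentagonal-regroup c′ N) ⟩
    eulerProd c (N ℕ.* 3) ⊛ ((𝟙 ⊕ ⊖ x^ (e₂ ℕ.* c)) ⊛ (𝟙 ⊕ ⊖ x^ (e₁ ℕ.* c)) ⊛ (𝟙 ⊕ ⊖ x^ (e₃ ℕ.* c)))
      ≈⟨ solve 4 (λ e a b d → e :* ((:1 :- a) :* (:1 :- b) :* (:1 :- d)) := e :* (:1 :- b) :* (:1 :- a) :* (:1 :- d))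
                 ≈-refl (eulerProd c (N ℕ.* 3)) (x^ (e₂ ℕ.* c)) (x^ (e₁ ℕ.* c)) (x^ (e₃ ℕ.* c)) ⟩
    eulerProd c (suc N ℕ.* 3)
      ∎
    where
    open ≈-Reasoning
    open Pentagonal c′
    c = suc c′
    e₁ = suc (N ℕ.* 3) ; e₂ = suc e₁ ; e₃ = suc e₂
    X≈ : X N ≈ ⊖ x^ (e₂ ℕ.* c)
    X≈ = ≈-trans (X-·x^ N) (neg-x^ (-1^-*-1^-odd N) (exponent N c′))
      where exponent : ∀ N c′ → suc N ℕ.* suc (c′ ℕ.+ suc c′) ℕ.+ N ℕ.* suc c′ ≡ suc (suc (N ℕ.* 3)) ℕ.* suc c′
            exponent = ℕ-solve-∀
    Z≈ : Z N ≈ ⊖ x^ (e₁ ℕ.* c)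
    Z≈ = ≈-trans (Z-·x^ N) (neg-x^ (-1^-*-1^-odd′ N) (exponent N c′))
      where exponent : ∀ N c′ → N ℕ.* suc (c′ ℕ.+ suc c′) ℕ.+ suc N ℕ.* suc c′ ≡ suc (N ℕ.* 3) ℕ.* suc c′
            exponent = ℕ-solve-∀
    y≈ : y ⊛^ suc N ≈ x^ (e₃ ℕ.* c)
    y≈ = ≈-trans (y⊛^-·x^ (suc N)) (·x^-cong (-1^-*-1^-even (suc N)) (exponent N c′))
      where exponent : ∀ N c′ → suc N ℕ.* suc (c′ ℕ.+ suc c′) ℕ.+ suc N ℕ.* suc c′ ≡ suc N ℕ.* 3 ℕ.* suc c′
            exponent = ℕ-solve-∀

module GuardedSums where

  open import Data.Bool using (Bool; true; false; if_then_else_; T; _∨_)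
  open import Data.Empty using (⊥; ⊥-elim)
  open import Data.Sum using (inj₁; inj₂)
  open import Data.List using (applyUpTo)
  open import Data.Bool.ListAction using (any)
  open import Data.Product using (∃-syntax; _×_; _,_)
  open import Relation.Nullary using (¬_)

  ∑If : ℕ → (ℕ → Bool) → (ℕ → ℤ) → ℤ
  ∑If L p a = ∑ L (λ i → if p i then a i else + 0)

  ∑If-none : ∀ L p a → (∀ i → i < L → ¬ T (p i)) → ∑If L p a ≡ + 0
  ∑If-none L p a none = trans (∑-cong-< L {g = λ _ → + 0} vanish) (∑-zero L (λ _ → refl))
    where
    vanish : ∀ i → i < L → (if p i then a i else + 0) ≡ + 0
    vanish i i<L with p i | none i i<L
    ... | true  | ¬⊤ = ⊥-elim (¬⊤ _)
    ... | false | _  = refl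

  ∑If-one : ∀ L p a i₀ → i₀ < L → T (p i₀) → (∀ i → i < L → T (p i) → i ≡ i₀) → ∑If L p a ≡ a i₀
  ∑If-one (suc L) p a zero _ hit unique with p 0
  ... | true  = trans (cong (ℤ._+_ (a 0)) (∑If-none L (λ i → p (suc i)) (λ i → a (suc i))
                                             (λ i i<L hitᵢ → ℕP.1+n≢0 (unique (suc i) (s≤s i<L) hitᵢ))))
                      (ℤP.+-identityʳ (a 0))
  ∑If-one (suc L) p a (suc i₀) (s≤s i₀<L) hit unique with p 0 | unique 0 (s≤s z≤n)
  ... | true  | unique₀ = ⊥-elim (ℕP.1+n≢0 (sym (unique₀ _)))
  ... | false | _       = trans (ℤP.+-identityˡ _)
                                (∑If-one L (λ i → p (suc i)) (λ i → a (suc i)) i₀ i₀<L hit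
                                   (λ i i<L hitᵢ → ℕP.suc-injective (unique (suc i) (s≤s i<L) hitᵢ)))

  ∑If-extend : ∀ L d p a → (∀ i → L ≤ i → ¬ T (p i)) → ∑If (L ℕ.+ d) p a ≡ ∑If L p a
  ∑If-extend L d p a beyond = begin
    ∑If (L ℕ.+ d) p a
      ≡⟨ ℤ-Sums.∑-split L d _ ⟩
    ∑If L p a ℤ.+ ∑If d (λ k → p (L ℕ.+ k)) (λ k → a (L ℕ.+ k))
      ≡⟨ cong (ℤ._+_ (∑If L p a)) (∑If-none d _ _ (λ k _ → beyond (L ℕ.+ k) (ℕP.m≤m+n L k))) ⟩
    ∑If L p a ℤ.+ + 0
      ≡⟨ ℤP.+-identityʳ _ ⟩
    ∑If L p a
      ∎
    where open ≡.≡-Reasoning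

  ∑If-range : ∀ L L′ p a → (∀ i → T (p i) → i < L) → (∀ i → T (p i) → i < L′) → ∑If L p a ≡ ∑If L′ p a
  ∑If-range L L′ p a below-L below-L′ with ℕP.≤-total L L′
  ... | inj₁ L≤L′ = trans (sym (∑If-extend L (L′ ∸ L) p a (λ i L≤i hit → ℕP.<⇒≱ (below-L i hit) L≤i)))
                          (cong (λ m → ∑If m p a) (ℕP.m+[n∸m]≡n L≤L′))
  ... | inj₂ L′≤L = trans (cong (λ m → ∑If m p a) (sym (ℕP.m+[n∸m]≡n L′≤L)))
                          (∑If-extend L′ (L ∸ L′) p a (λ i L′≤i hit → ℕP.<⇒≱ (below-L′ i hit) L′≤i))

  ∑If-∨ : ∀ L p q a → (∀ i → T (p i) → T (q i) → ⊥) →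
          ∑If L (λ i → p i ∨ q i) a ≡ ∑If L p a ℤ.+ ∑If L q a
  ∑If-∨ L p q a disjoint = trans (∑-cong L split) (ℤ-Sums.∑-distrib-+ L _ _)
    where
    split : ∀ i → (if p i ∨ q i then a i else + 0) ≡ (if p i then a i else + 0) ℤ.+ (if q i then a i else + 0)
    split i with p i | q i | disjoint i
    ... | true  | true  | both = ⊥-elim (both _ _)
    ... | true  | false | _    = sym (ℤP.+-identityʳ _)
    ... | false | true  | _    = sym (ℤP.+-identityˡ _)
    ... | false | false | _    = refl

  any-sound : ∀ p (f : ℕ → ℕ) L → T (any p (applyUpTo f L)) → ∃[ i ] (i < L × T (p (f i)))
  any-sound p f (suc L) hit with p (f 0) in p0
  ... | true  = 0 , s≤s z≤n , subst T (sym p0) _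
  ... | false with any-sound p (λ i → f (suc i)) L hit
  ...   | i , i<L , hitᵢ = suc i , s≤s i<L , hitᵢ

  any-complete : ∀ p (f : ℕ → ℕ) L i → i < L → T (p (f i)) → T (any p (applyUpTo f L))
  any-complete p f (suc L) zero    _         hit = T-∨ˡ hit
    where T-∨ˡ : ∀ {a b} → T a → T (a ∨ b)
          T-∨ˡ {true} _ = _
  any-complete p f (suc L) (suc i) (s≤s i<L) hit = T-∨ʳ (any-complete p (λ i → f (suc i)) L i i<L hit)
    where T-∨ʳ : ∀ {a b} → T b → T (a ∨ b)
          T-∨ʳ {true}  _ = _
          T-∨ʳ {false} t = t

module FigurateNumbers where

  open JacobiExponents using (tri; n≤tri; tri-double)
  open import Data.Nat using (_+_; _*_; _∸_; _≤_; _<_; z≤n; s≤s)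
  open import Data.Empty using (⊥-elim)
  open ≡ using (_≢_; subst₂)
  open import Data.Sum using (inj₁; inj₂)
  open import Relation.Binary.Definitions using (tri<; tri≈; tri>)
  open import Data.Nat.Tactic.RingSolver using (solve-∀)

  strictlyIncreasing⇒injective : ∀ (f : ℕ → ℕ) → (∀ {a b} → a < b → f a < f b) → ∀ {a b} → f a ≡ f b → a ≡ b
  strictlyIncreasing⇒injective f increasing {a} {b} fa≡fb with ℕP.<-cmp a b
  ... | tri< a<b _ _ = ⊥-elim (ℕP.<-irrefl fa≡fb (increasing a<b))
  ... | tri≈ _ a≡b _ = a≡b
  ... | tri> _ _ b<a = ⊥-elim (ℕP.<-irrefl (sym fa≡fb) (increasing b<a))

  n≤n*n : ∀ n → n ≤ n * n
  n≤n*n zero    = z≤n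
  n≤n*n (suc n) = ℕP.m≤m*n (suc n) (suc n)

  square-injective : ∀ {a b} → a * a ≡ b * b → a ≡ b
  square-injective = strictlyIncreasing⇒injective (λ k → k * k) (λ a<b → ℕP.*-mono-< a<b a<b)

  tri-<-mono : ∀ {a b} → a < b → tri a < tri b
  tri-<-mono {zero}  {suc b} _         = s≤s z≤n
  tri-<-mono {suc a} {suc b} (s≤s a<b) = ℕP.+-mono-< (s≤s a<b) (tri-<-mono a<b)

  tri-≤-mono : ∀ {a b} → a ≤ b → tri a ≤ tri b
  tri-≤-mono a≤b with ℕP.m≤n⇒m<n∨m≡n a≤b
  ... | inj₁ a<b  = ℕP.<⇒≤ (tri-<-mono a<b)
  ... | inj₂ refl = ℕP.≤-refl

  tri-injective : ∀ {a b} → tri a ≡ tri b → a ≡ b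
  tri-injective = strictlyIncreasing⇒injective tri tri-<-mono

  -- pent⁺ k and pent⁻ (k - 1) are the generalised pentagonal numbers (3k² + k)/2 and (3k² - k)/2.
  pent⁺ : ℕ → ℕ
  pent⁺ k = tri k + tri k + tri (k ∸ 1)

  pent⁻ : ℕ → ℕ
  pent⁻ K = tri K + tri K + tri (suc K)

  2*pent⁺ : ∀ j → 2 * pent⁺ (suc j) ≡ 3 * suc j * suc j + suc j
  2*pent⁺ j = begin
    2 * pent⁺ (suc j)                                     ≡⟨ regroup (tri (suc j)) (tri j) ⟩
    (a + a) + (a + a) + (b + b)                           ≡⟨ cong₂ (λ x y → x + x + y) (tri-double (suc j)) (tri-double j) ⟩
    suc j * suc (suc j) + suc j * suc (suc j) + j * suc j ≡⟨ close j ⟩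
    3 * suc j * suc j + suc j                             ∎
    where
    open ≡.≡-Reasoning
    a = tri (suc j) ; b = tri j
    regroup : ∀ a b → 2 * (a + a + b) ≡ (a + a) + (a + a) + (b + b)
    regroup = solve-∀
    close : ∀ j → suc j * suc (suc j) + suc j * suc (suc j) + j * suc j ≡ 3 * suc j * suc j + suc j
    close = solve-∀

  2*pent⁻ : ∀ j → 2 * pent⁻ j ≡ 3 * suc j * suc j ∸ suc j
  2*pent⁻ j = begin
    2 * pent⁻ j                                          ≡⟨ regroup (tri j) (tri (suc j)) ⟩
    (a + a) + (a + a) + (b + b)                          ≡⟨ cong₂ (λ x y → x + x + y) (tri-double j) (tri-double (suc j)) ⟩
    j * suc j + j * suc j + suc j * suc (suc j)          ≡⟨ ℕP.m+n∸n≡m _ (suc j) ⟨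
    j * suc j + j * suc j + suc j * suc (suc j) + suc j ∸ suc j ≡⟨ cong (_∸ suc j) (close j) ⟩
    3 * suc j * suc j ∸ suc j                            ∎
    where
    open ≡.≡-Reasoning
    a = tri j ; b = tri (suc j)
    regroup : ∀ a b → 2 * (a + a + b) ≡ (a + a) + (a + a) + (b + b)
    regroup = solve-∀
    close : ∀ j → j * suc j + j * suc j + suc j * suc (suc j) + suc j ≡ 3 * suc j * suc j
    close = solve-∀

  pent⁺-<-mono : ∀ {a b} → a < b → pent⁺ a < pent⁺ b
  pent⁺-<-mono {a} {b} a<b = ℕP.+-mono-<-≤ (ℕP.+-mono-< (tri-<-mono a<b) (tri-<-mono a<b)) (pred-mono a<b)
    where pred-mono : ∀ {a b} → a < b → tri (a ∸ 1) ≤ tri (b ∸ 1)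
          pred-mono {zero}  _         = z≤n
          pred-mono {suc a} (s≤s a<b) = tri-≤-mono (ℕP.<⇒≤ a<b)

  pent⁻-<-mono : ∀ {a b} → a < b → pent⁻ a < pent⁻ b
  pent⁻-<-mono a<b = ℕP.+-mono-< (ℕP.+-mono-< (tri-<-mono a<b) (tri-<-mono a<b)) (tri-<-mono (s≤s a<b))

  pent⁺-injective : ∀ {a b} → pent⁺ a ≡ pent⁺ b → a ≡ b
  pent⁺-injective = strictlyIncreasing⇒injective pent⁺ pent⁺-<-mono

  pent⁻-injective : ∀ {a b} → pent⁻ a ≡ pent⁻ b → a ≡ b
  pent⁻-injective = strictlyIncreasing⇒injective pent⁻ pent⁻-<-mono

  n≤pent⁺ : ∀ k → k ≤ pent⁺ k
  n≤pent⁺ k = ℕP.≤-trans (n≤tri k) (ℕP.≤-trans (ℕP.m≤m+n (tri k) (tri k)) (ℕP.m≤m+n _ _))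

  n<pent⁻ : ∀ K → K < pent⁻ K
  n<pent⁻ K = ℕP.≤-trans (n≤tri (suc K)) (ℕP.m≤n+m _ _)

  pent⁺-≤-mono : ∀ {a b} → a ≤ b → pent⁺ a ≤ pent⁺ b
  pent⁺-≤-mono a≤b with ℕP.m≤n⇒m<n∨m≡n a≤b
  ... | inj₁ a<b  = ℕP.<⇒≤ (pent⁺-<-mono a<b)
  ... | inj₂ refl = ℕP.≤-refl

  pent⁺<pent⁻ : ∀ k → pent⁺ k < pent⁻ k
  pent⁺<pent⁻ k = ℕP.+-monoʳ-< (tri k + tri k) (ℕP.≤-<-trans (tri-≤-mono (ℕP.m∸n≤m k 1)) (tri-<-mono (ℕP.n<1+n k)))

  pent⁻<pent⁺ : ∀ K → pent⁻ K < pent⁺ (suc K)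
  pent⁻<pent⁺ K = subst₂ _<_ (sym (left (tri K) (tri (suc K)))) (sym (right (tri K) (tri (suc K))))
                    (ℕP.+-monoʳ-< (tri K + tri (suc K)) (tri-<-mono (ℕP.n<1+n K)))
    where
    left : ∀ a b → a + a + b ≡ (a + b) + a
    left = solve-∀
    right : ∀ a b → b + b + a ≡ (a + b) + b
    right = solve-∀

  pent⁺≢pent⁻ : ∀ k K → pent⁺ k ≢ pent⁻ K
  pent⁺≢pent⁻ k K eq with ℕP.≤-total k K
  ... | inj₁ k≤K = ℕP.<-irrefl eq (ℕP.≤-<-trans (pent⁺-≤-mono k≤K) (pent⁺<pent⁻ K))
  ... | inj₂ K≤k with ℕP.m≤n⇒m<n∨m≡n K≤k
  ...   | inj₂ refl = ℕP.<-irrefl eq (pent⁺<pent⁻ k)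
  ...   | inj₁ K<k  = ℕP.<-irrefl (sym eq) (ℕP.<-≤-trans (pent⁻<pent⁺ K) (pent⁺-≤-mono K<k))

module Coefficients where

  open PowerSeries
  open SeriesAlgebra
  open Specialisations
  open GuardedSums
  open FigurateNumbers
  open Signs
  open JacobiExponents using (tri; n≤tri; tri-double; tri-+-tri-suc; tri-+-tri-pred)
  open import Defs using (sgn; isSquare; isTriangular; ω; ω′; omegaSearch)
  open import Data.Bool using (Bool; true; false; if_then_else_; T; _∨_)
  open import Data.Empty using (⊥-elim)
  open import Function using (case_of_)
  open import Relation.Nullary using (¬_)
  open import Data.Sum using (_⊎_; inj₁; inj₂)
  open import Data.List using (applyUpTo)
  open import Data.Product using (∃-syntax; _,_)
  open import Data.Integer.Tactic.RingSolver using (solve-∀)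
  open import Data.Nat.Tactic.RingSolver using () renaming (solve-∀ to ℕ-solve-∀)

  guard-cong : ∀ {b b′ x x′} → b ≡ b′ → x ≡ x′ → (if b then x else + 0) ≡ (if b′ then x′ else + 0)
  guard-cong = cong₂ (λ b x → if b then x else + 0)

  ≡ᵇ-cong : ∀ {m m′ n} → m ≡ m′ → (m ℕ.≡ᵇ n) ≡ (m′ ℕ.≡ᵇ n)
  ≡ᵇ-cong = cong (ℕ._≡ᵇ _)

  hit⇒≡ : ∀ {m n} → T (m ℕ.≡ᵇ n) → m ≡ n
  hit⇒≡ = ℕP.≡ᵇ⇒≡ _ _

  ≡⇒hit : ∀ {m n} → m ≡ n → T (m ℕ.≡ᵇ n)
  ≡⇒hit = ℕP.≡⇒≡ᵇ _ _

  2*-double : ∀ n → 2 ℕ.* n ≡ n ℕ.+ n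
  2*-double n = cong (n ℕ.+_) (ℕP.+-identityʳ n)

  sgn-tri-+-tri-suc : ∀ K → sgn (tri K ℕ.+ tri (suc K)) ≡ sgn (suc K)
  sgn-tri-+-tri-suc K = trans (cong sgn (tri-+-tri-suc K)) (sgn-square (suc K))

  sgn-tri-+-tri-pred : ∀ k → sgn (tri k ℕ.+ tri (k ∸ 1)) ≡ sgn k
  sgn-tri-+-tri-pred k = trans (cong sgn (tri-+-tri-pred k)) (sgn-square k)

  squares : Series
  squares zero    = + 0
  squares (suc k) = if isSquare (suc k) then sgn (suc k) else + 0

  isSquare-sound : ∀ n → T (isSquare n) → ∃[ m ] m ℕ.* m ≡ n
  isSquare-sound n sq with any-sound (λ m → m ℕ.* m ℕ.≡ᵇ n) (λ m → m) (suc n) sq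
  ... | m , _ , m²≡n = m , hit⇒≡ m²≡n

  isSquare-complete : ∀ m n → m ℕ.* m ≡ n → T (isSquare n)
  isSquare-complete m n m²≡n = any-complete (λ m → m ℕ.* m ℕ.≡ᵇ n) (λ m → m) (suc n) m
                                 (s≤s (subst (m ℕ.≤_) m²≡n (n≤n*n m))) (≡⇒hit m²≡n)

  squares-hits : ∀ N n → n < N → ∑If N (λ K → suc K ℕ.* suc K ℕ.≡ᵇ n) (λ K → sgn (suc K)) ≡ squares n
  squares-hits N zero    _   = ∑If-none N _ (λ K → sgn (suc K)) (λ _ _ ())
  squares-hits N (suc m) n<N with isSquare (suc m) in isSq
  ... | false = ∑If-none N _ _ (λ K _ hit → subst T isSq (isSquare-complete (suc K) (suc m) (hit⇒≡ hit)))
  ... | true with isSquare-sound (suc m) (subst T (sym isSq) _)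
  ...   | suc K₀ , K₀²≡n = trans (∑If-one N _ _ K₀ K₀<N (≡⇒hit K₀²≡n)
                                   (λ K _ hit → ℕP.suc-injective (square-injective (trans (hit⇒≡ hit) (sym K₀²≡n)))))
                                 (trans (sym (sgn-square (suc K₀))) (cong sgn K₀²≡n))
    where K₀<N = ℕP.≤-trans (subst (suc K₀ ℕ.≤_) K₀²≡n (n≤n*n (suc K₀))) (ℕP.<⇒≤ n<N)

  origin : ∀ n → (if 0 ℕ.≡ᵇ n then + 1 else + 0) ≡ 𝟙 n
  origin zero    = refl
  origin (suc n) = refl

  theta-limit : ∀ N → Theta.jacobiSum N ≈[< N ] 𝟙 ⊕ (squares ⊕ squares)
  theta-limit N = mk≈< λ n n<N → begin
    Theta.jacobiSum N n
      ≡⟨ Theta.jacobiSum-coeff N n ⟩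
    ∑ N (λ K → Theta.term n (tri K) (tri (suc K))) ℤ.+ ∑ (suc N) (λ k → Theta.term n (tri k) (tri (k ∸ 1)))
      ≡⟨ cong₂ ℤ._+_ (∑-cong N (lower n)) (∑-cong (suc N) (upper n)) ⟩
    S n ℤ.+ ((if 0 ℕ.≡ᵇ n then + 1 else + 0) ℤ.+ S n)
      ≡⟨ cong₂ (λ h o → h ℤ.+ (o ℤ.+ h)) (squares-hits N n n<N) (origin n) ⟩
    squares n ℤ.+ (𝟙 n ℤ.+ squares n)
      ≡⟨ regroup (squares n) (𝟙 n) ⟩
    (𝟙 ⊕ (squares ⊕ squares)) n
      ∎
    where
    open ≡.≡-Reasoning
    S : ℕ → ℤ
    S n = ∑If N (λ K → suc K ℕ.* suc K ℕ.≡ᵇ n) (λ K → sgn (suc K))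
    regroup : ∀ h o → h ℤ.+ (o ℤ.+ h) ≡ o ℤ.+ (h ℤ.+ h)
    regroup = solve-∀
    lower : ∀ n K → Theta.term n (tri K) (tri (suc K)) ≡ (if suc K ℕ.* suc K ℕ.≡ᵇ n then sgn (suc K) else + 0)
    lower n K = guard-cong (≡ᵇ-cong (trans (cong₂ ℕ._+_ (ℕP.*-identityʳ (tri K)) (ℕP.*-identityʳ (tri (suc K))))
                                           (tri-+-tri-suc K)))
                           (trans (-1^-*-1^ (tri K) (tri (suc K))) (sgn-tri-+-tri-suc K))
    upper : ∀ n k → Theta.term n (tri k) (tri (k ∸ 1)) ≡ (if k ℕ.* k ℕ.≡ᵇ n then sgn k else + 0)
    upper n k = guard-cong (≡ᵇ-cong (trans (cong₂ ℕ._+_ (ℕP.*-identityʳ (tri k)) (ℕP.*-identityʳ (tri (k ∸ 1))))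
                                           (tri-+-tri-pred k)))
                           (trans (-1^-*-1^ (tri k) (tri (k ∸ 1))) (sgn-tri-+-tri-pred k))

  triangles : Series
  triangles zero    = + 0
  triangles (suc k) = if isTriangular (suc k) then + 1 else + 0

  isTriangular-sound : ∀ n → T (isTriangular (suc n)) → ∃[ m ] tri (suc m) ≡ suc n
  isTriangular-sound n tr with any-sound (λ m → suc m ℕ.* suc (suc m) ℕ.≡ᵇ 2 ℕ.* suc n) (λ m → m) (suc n) tr
  ... | m , _ , hit = m , ℕP.*-cancelˡ-≡ (tri (suc m)) (suc n) 2
                             (trans (2*-double (tri (suc m))) (trans (tri-double (suc m)) (hit⇒≡ hit)))

  isTriangular-complete : ∀ m n → tri (suc m) ≡ suc n → T (isTriangular (suc n))
  isTriangular-complete m n t≡n =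
    any-complete (λ m → suc m ℕ.* suc (suc m) ℕ.≡ᵇ 2 ℕ.* suc n) (λ m → m) (suc n) m
      (subst (suc m ℕ.≤_) t≡n (n≤tri (suc m)))
      (≡⇒hit (trans (sym (tri-double (suc m))) (trans (cong (λ x → x ℕ.+ x) t≡n) (sym (2*-double (suc n))))))

  triangles-hits : ∀ N n → n < N → ∑If N (λ K → tri K ℕ.≡ᵇ n) (λ _ → + 1) ≡ (𝟙 ⊕ triangles) n
  triangles-hits N zero    0<N = ∑If-one N _ (λ _ → + 1) 0 0<N _ (λ K _ hit → tri-injective (hit⇒≡ hit))
  triangles-hits N (suc m) n<N with isTriangular (suc m) in isTri
  ... | false = ∑If-none N (λ K → tri K ℕ.≡ᵇ suc m) (λ _ → + 1) (λ where
                  zero    _ ()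
                  (suc K) _ hit → subst T isTri (isTriangular-complete K m (hit⇒≡ hit)))
  ... | true with isTriangular-sound m (subst T (sym isTri) _)
  ...   | m₀ , t≡n = ∑If-one N _ (λ _ → + 1) (suc m₀) m₀<N (≡⇒hit t≡n)
                       (λ K _ hit → tri-injective (trans (hit⇒≡ hit) (sym t≡n)))
    where m₀<N = ℕP.≤-<-trans (subst (suc m₀ ℕ.≤_) t≡n (n≤tri (suc m₀))) n<N

  psi-limit : ∀ N → Psi.jacobiSum N ≈[< N ] scale (+ 2) (𝟙 ⊕ triangles)
  psi-limit N = mk≈< λ n n<N → begin
    Psi.jacobiSum N n
      ≡⟨ Psi.jacobiSum-coeff N n ⟩
    ∑ N (λ K → Psi.term n (tri K) (tri (suc K))) ℤ.+ ∑ (suc N) (λ k → Psi.term n (tri k) (tri (k ∸ 1)))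
      ≡⟨ cong₂ ℤ._+_ (∑-cong N (λ K → simplify n (tri K) (tri (suc K))))
                     (∑-cong (suc N) (λ k → simplify n (tri k) (tri (k ∸ 1)))) ⟩
    H n ℤ.+ ∑If (suc N) (λ k → tri k ℕ.≡ᵇ n) (λ _ → + 1)
      ≡⟨ cong (ℤ._+_ (H n)) (∑If-range (suc N) N _ _ (λ k hit → ℕP.<-trans (bound n<N k hit) (ℕP.n<1+n N))
                                                     (bound n<N)) ⟩
    H n ℤ.+ H n
      ≡⟨ cong (λ h → h ℤ.+ h) (triangles-hits N n n<N) ⟩
    (𝟙 ⊕ triangles) n ℤ.+ (𝟙 ⊕ triangles) n
      ≡⟨ double ((𝟙 ⊕ triangles) n) ⟩
    + 2 ℤ.* (𝟙 ⊕ triangles) n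
      ∎
    where
    open ≡.≡-Reasoning
    H : ℕ → ℤ
    H n = ∑If N (λ K → tri K ℕ.≡ᵇ n) (λ _ → + 1)
    double : ∀ h → h ℤ.+ h ≡ + 2 ℤ.* h
    double = solve-∀
    bound : ∀ {n} → n < N → ∀ k → T (tri k ℕ.≡ᵇ n) → k < N
    bound n<N k hit = ℕP.≤-<-trans (subst (k ℕ.≤_) (hit⇒≡ hit) (n≤tri k)) n<N
    simplify : ∀ n p q → Psi.term n p q ≡ (if p ℕ.≡ᵇ n then + 1 else + 0)
    simplify n p q = guard-cong (≡ᵇ-cong (trans (cong₂ ℕ._+_ (ℕP.*-identityʳ p) (ℕP.*-zeroʳ q)) (ℕP.+-identityʳ p)))
                                (cong₂ ℤ._*_ (ℤP.^-zeroˡ p) (ℤP.^-zeroˡ q))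

  Bool-ext : ∀ {a b} → (T a → T b) → (T b → T a) → a ≡ b
  Bool-ext {true}  {true}  _   _   = refl
  Bool-ext {true}  {false} a⇒b _   = ⊥-elim (a⇒b _)
  Bool-ext {false} {true}  _   b⇒a = ⊥-elim (b⇒a _)
  Bool-ext {false} {false} _   _   = refl

  ≡ᵇ-≡ : ∀ {m n m′ n′} → (m ≡ n → m′ ≡ n′) → (m′ ≡ n′ → m ≡ n) → (m ℕ.≡ᵇ n) ≡ (m′ ℕ.≡ᵇ n′)
  ≡ᵇ-≡ to from = Bool-ext (λ hit → ≡⇒hit (to (hit⇒≡ hit))) (λ hit → ≡⇒hit (from (hit⇒≡ hit)))

  pentagonal-coeff : ∀ c′ N n → Pentagonal.jacobiSum c′ N n ≡
    ∑If N (λ K → pent⁻ K ℕ.* suc c′ ℕ.≡ᵇ n) (λ K → sgn (suc K)) ℤ.+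
    ∑If (suc N) (λ k → pent⁺ k ℕ.* suc c′ ℕ.≡ᵇ n) sgn
  pentagonal-coeff c′ N n = trans (Pentagonal.jacobiSum-coeff c′ N n) (cong₂ ℤ._+_ (∑-cong N lower) (∑-cong (suc N) upper))
    where
    degree : ∀ p q → Pentagonal.degree c′ p q ≡ (p ℕ.+ p ℕ.+ q) ℕ.* suc c′
    degree p q = normalise p q c′
      where normalise : ∀ p q c′ → p ℕ.* suc (c′ ℕ.+ suc c′) ℕ.+ q ℕ.* suc c′ ≡ (p ℕ.+ p ℕ.+ q) ℕ.* suc c′
            normalise = ℕ-solve-∀
    lower : ∀ K → Pentagonal.term c′ n (tri K) (tri (suc K)) ≡ (if pent⁻ K ℕ.* suc c′ ℕ.≡ᵇ n then sgn (suc K) else + 0)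
    lower K = guard-cong (≡ᵇ-cong (degree (tri K) (tri (suc K))))
                         (trans (-1^-*-1^ (tri K) (tri (suc K))) (sgn-tri-+-tri-suc K))
    upper : ∀ k → Pentagonal.term c′ n (tri k) (tri (k ∸ 1)) ≡ (if pent⁺ k ℕ.* suc c′ ℕ.≡ᵇ n then sgn k else + 0)
    upper k = guard-cong (≡ᵇ-cong (degree (tri k) (tri (k ∸ 1))))
                         (trans (-1^-*-1^ (tri k) (tri (k ∸ 1))) (sgn-tri-+-tri-pred k))

  pentagonal? : ℕ → ℕ → Bool
  pentagonal? m j = ((2 ℕ.* m) ℕ.≡ᵇ (3 ℕ.* suc j ℕ.* suc j ℕ.+ suc j))
                  ∨ ((2 ℕ.* m) ℕ.≡ᵇ (3 ℕ.* suc j ℕ.* suc j ∸ suc j))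

  pentagonal?-pent : ∀ m j → pentagonal? m j ≡ ((pent⁺ (suc j) ℕ.≡ᵇ m) ∨ (pent⁻ j ℕ.≡ᵇ m))
  pentagonal?-pent m j = cong₂ _∨_ (halve (pent⁺ (suc j)) (2*pent⁺ j)) (halve (pent⁻ j) (2*pent⁻ j))
    where
    halve : ∀ p {e} → 2 ℕ.* p ≡ e → (2 ℕ.* m ℕ.≡ᵇ e) ≡ (p ℕ.≡ᵇ m)
    halve p {e} 2p≡e = ≡ᵇ-≡ {2 ℕ.* m} {e} {p} {m} (λ 2m≡e → ℕP.*-cancelˡ-≡ p m 2 (trans 2p≡e (sym 2m≡e)))
                          (λ p≡m → trans (cong (2 ℕ.*_) (sym p≡m)) 2p≡e)

  split-∨ : ∀ a {b} → T (a ∨ b) → T a ⊎ T b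
  split-∨ true  t = inj₁ t
  split-∨ false t = inj₂ t

  pentagonal?-values : ∀ m j → T (pentagonal? m j) → pent⁺ (suc j) ≡ m ⊎ pent⁻ j ≡ m
  pentagonal?-values m j hit with split-∨ (pent⁺ (suc j) ℕ.≡ᵇ m) (subst T (pentagonal?-pent m j) hit)
  ... | inj₁ hit⁺ = inj₁ (ℕP.≡ᵇ⇒≡ (pent⁺ (suc j)) m hit⁺)
  ... | inj₂ hit⁻ = inj₂ (ℕP.≡ᵇ⇒≡ (pent⁻ j) m hit⁻)

  pentagonal?-unique : ∀ m {i i′} → T (pentagonal? m i) → T (pentagonal? m i′) → i ≡ i′
  pentagonal?-unique m {i} {i′} hit hit′ with pentagonal?-values m i hit | pentagonal?-values m i′ hit′
  ... | inj₁ e | inj₁ e′ = ℕP.suc-injective (pent⁺-injective (trans e (sym e′)))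
  ... | inj₁ e | inj₂ e′ = ⊥-elim (pent⁺≢pent⁻ (suc i) i′ (trans e (sym e′)))
  ... | inj₂ e | inj₁ e′ = ⊥-elim (pent⁺≢pent⁻ (suc i′) i (trans e′ (sym e)))
  ... | inj₂ e | inj₂ e′ = pent⁻-injective (trans e (sym e′))

  omegaSearch-∑If : ∀ m (f : ℕ → ℕ) L →
                    (∀ {i i′} → T (pentagonal? m (f i)) → T (pentagonal? m (f i′)) → i ≡ i′) →
                    omegaSearch m (applyUpTo f L) ≡ ∑If L (λ i → pentagonal? m (f i)) (λ i → sgn (suc (f i)))
  omegaSearch-∑If m f zero    _      = refl
  omegaSearch-∑If m f (suc L) unique with pentagonal? m (f 0) in hit₀
  ... | true  = sym (trans (cong (ℤ._+_ (sgn (suc (f 0))))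
                                 (∑If-none L _ _ (λ i _ hitᵢ → ℕP.1+n≢0 (unique hitᵢ (subst T (sym hit₀) _)))))
                           (ℤP.+-identityʳ _))
  ... | false = trans (omegaSearch-∑If m (λ i → f (suc i)) L (λ hit hit′ → ℕP.suc-injective (unique hit hit′)))
                      (sym (ℤP.+-identityˡ _))

  omega-hits : ∀ N n → n < N →
    ∑If N (λ K → pent⁻ K ℕ.≡ᵇ n) (λ K → sgn (suc K)) ℤ.+ ∑If (suc N) (λ k → pent⁺ k ℕ.≡ᵇ n) sgn ≡ ω n
  omega-hits N zero    _   =
    cong₂ ℤ._+_ (∑If-none N (λ K → pent⁻ K ℕ.≡ᵇ 0) (λ K → sgn (suc K))
                   (λ K _ hit → ℕP.n≮0 (subst (K <_) (ℕP.≡ᵇ⇒≡ (pent⁻ K) 0 hit) (n<pent⁻ K))))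
                (cong (ℤ._+_ (+ 1)) (∑If-none N (λ j → pent⁺ (suc j) ℕ.≡ᵇ 0) (λ j → sgn (suc j)) (λ _ _ ())))
  omega-hits N (suc m) n<N = begin
    ∑If N P⁻ a ℤ.+ ∑If (suc N) (λ k → pent⁺ k ℕ.≡ᵇ n) sgn
      ≡⟨ cong₂ ℤ._+_ (∑If-range N n P⁻ a (λ K hit → ℕP.<-trans (K<n K hit) n<N) (K<n))
                     (trans (ℤP.+-identityˡ _) (∑If-range N n P⁺ a (λ j hit → ℕP.<-trans (j<n j hit) n<N) j<n)) ⟩
    ∑If n P⁻ a ℤ.+ ∑If n P⁺ a
      ≡⟨ ℤP.+-comm (∑If n P⁻ a) (∑If n P⁺ a) ⟩
    ∑If n P⁺ a ℤ.+ ∑If n P⁻ a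
      ≡⟨ ∑If-∨ n P⁺ P⁻ a (λ j hit⁺ hit⁻ → pent⁺≢pent⁻ (suc j) j (trans (ℕP.≡ᵇ⇒≡ _ n hit⁺)
                                                                      (sym (ℕP.≡ᵇ⇒≡ _ n hit⁻)))) ⟨
    ∑If n (λ j → P⁺ j ∨ P⁻ j) a
      ≡⟨ ∑-cong n {g = λ j → if P⁺ j ∨ P⁻ j then a j else + 0} (λ j → guard-cong (pentagonal?-pent n j) refl) ⟨
    ∑If n (pentagonal? n) a
      ≡⟨ omegaSearch-∑If n (λ j → j) n (pentagonal?-unique n) ⟨
    ω n
      ∎
    where
    open ≡.≡-Reasoning
    n = suc m
    P⁺ P⁻ : ℕ → Bool
    P⁺ j = pent⁺ (suc j) ℕ.≡ᵇ n
    P⁻ K = pent⁻ K ℕ.≡ᵇ n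
    a : ℕ → ℤ
    a j = sgn (suc j)
    K<n : ∀ K → T (P⁻ K) → K < n
    K<n K hit = subst (K <_) (ℕP.≡ᵇ⇒≡ (pent⁻ K) n hit) (n<pent⁻ K)
    j<n : ∀ j → T (P⁺ j) → j < n
    j<n j hit = subst (suc j ℕ.≤_) (ℕP.≡ᵇ⇒≡ (pent⁺ (suc j)) n hit) (n≤pent⁺ (suc j))

  omega-limit : ∀ N → Pentagonal.jacobiSum 0 N ≈[< N ] ω
  omega-limit N = mk≈< λ n n<N →
    trans (pentagonal-coeff 0 N n)
          (trans (cong₂ ℤ._+_ (∑-cong N {g = λ K → if pent⁻ K ℕ.≡ᵇ n then sgn (suc K) else + 0}
                                       (λ K → guard-cong (≡ᵇ-cong (ℕP.*-identityʳ (pent⁻ K))) refl))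
                              (∑-cong (suc N) {g = λ k → if pent⁺ k ℕ.≡ᵇ n then sgn k else + 0}
                                       (λ k → guard-cong (≡ᵇ-cong (ℕP.*-identityʳ (pent⁺ k))) refl)))
                 (omega-hits N n n<N))

  omega′-limit : ∀ N → Pentagonal.jacobiSum 1 N ≈[< N ] ω′
  omega′-limit N = mk≈< λ n n<N → trans (pentagonal-coeff 1 N n) (evaluate n n<N)
    where
    open import Data.Nat.DivMod using (_%_; _/_; m≡m%n+[m/n]*n; m*n%n≡0; m%n<n; m/n≤m)
    evaluate : ∀ n → n < N → ∑If N (λ K → pent⁻ K ℕ.* 2 ℕ.≡ᵇ n) (λ K → sgn (suc K))
                               ℤ.+ ∑If (suc N) (λ k → pent⁺ k ℕ.* 2 ℕ.≡ᵇ n) sgn ≡ ω′ n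
    evaluate n n<N with (n % 2) ℕ.≡ᵇ 1 in odd
    ... | true  = cong₂ ℤ._+_ (∑If-none N _ (λ K → sgn (suc K)) (λ K _ → not-double (pent⁻ K)))
                              (∑If-none (suc N) _ sgn (λ k _ → not-double (pent⁺ k)))
      where
      not-double : ∀ x → ¬ T (x ℕ.* 2 ℕ.≡ᵇ n)
      not-double x hit = case trans (sym odd) (cong (ℕ._≡ᵇ 1) (trans (cong (_% 2) (sym (ℕP.≡ᵇ⇒≡ (x ℕ.* 2) n hit)))
                                                                      (m*n%n≡0 x 2))) of λ ()
    ... | false = trans (cong₂ ℤ._+_ (∑-cong N {g = λ K → if pent⁻ K ℕ.≡ᵇ n / 2 then sgn (suc K) else + 0}
                                             (λ K → guard-cong (halve (pent⁻ K)) refl))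
                                     (∑-cong (suc N) {g = λ k → if pent⁺ k ℕ.≡ᵇ n / 2 then sgn k else + 0}
                                             (λ k → guard-cong (halve (pent⁺ k)) refl)))
                        (omega-hits N (n / 2) (ℕP.≤-<-trans (m/n≤m n 2) n<N))
      where
      n≡half*2 : n ≡ n / 2 ℕ.* 2
      n≡half*2 = trans (m≡m%n+[m/n]*n n 2) (cong (ℕ._+ n / 2 ℕ.* 2) (remainder (n % 2) (m%n<n n 2) odd))
        where remainder : ∀ r → r < 2 → (r ℕ.≡ᵇ 1) ≡ false → r ≡ 0
              remainder zero          _ _ = refl
              remainder (suc zero)    _ ()
              remainder (suc (suc r)) (s≤s (s≤s ())) _
      halve : ∀ x → (x ℕ.* 2 ℕ.≡ᵇ n) ≡ (x ℕ.≡ᵇ n / 2)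
      halve x = ≡ᵇ-≡ {x ℕ.* 2} {n} {x} {n / 2} (λ x*2≡n → ℕP.*-cancelʳ-≡ x (n / 2) 2 (trans x*2≡n n≡half*2))
                                               (λ x≡half → trans (cong (ℕ._* 2) x≡half) (sym n≡half*2))

module Compositions where

  open import Defs using (compsF; countComps)
  open import Data.Bool using (Bool; true; false; if_then_else_; T?; _∧_)
  open import Data.Bool.ListAction using (all)
  open import Data.List using (List; []; _∷_; _++_; map; concatMap; applyUpTo; filter; length)

  ind : Bool → ℤ
  ind b = if b then + 1 else + 0

  # : (List ℕ → Bool) → List (List ℕ) → ℤ
  # P []       = + 0
  # P (c ∷ cs) = ind (P c) ℤ.+ # P cs

  length-filter : ∀ P cs → + length (filter (λ c → T? (P c)) cs) ≡ # P cs
  length-filter P []       = refl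
  length-filter P (c ∷ cs) with P c
  ... | true  = cong (ℤ._+_ (+ 1)) (length-filter P cs)
  ... | false = trans (length-filter P cs) (sym (ℤP.+-identityˡ _))

  #-++ : ∀ P xs ys → # P (xs ++ ys) ≡ # P xs ℤ.+ # P ys
  #-++ P []       ys = sym (ℤP.+-identityˡ _)
  #-++ P (x ∷ xs) ys = trans (cong (ℤ._+_ (ind (P x))) (#-++ P xs ys)) (sym (ℤP.+-assoc (ind (P x)) (# P xs) (# P ys)))

  #-concatMap : ∀ P (g : ℕ → List (List ℕ)) f L → # P (concatMap g (applyUpTo f L)) ≡ ∑ L (λ k → # P (g (f k)))
  #-concatMap P g f zero    = refl
  #-concatMap P g f (suc L) = trans (#-++ P (g (f 0)) _) (cong (ℤ._+_ (# P (g (f 0)))) (#-concatMap P g (λ k → f (suc k)) L))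

  #-map-∷ : ∀ P a cs → # P (map (a ∷_) cs) ≡ # (λ c → P (a ∷ c)) cs
  #-map-∷ P a []       = refl
  #-map-∷ P a (c ∷ cs) = cong (ℤ._+_ (ind (P (a ∷ c)))) (#-map-∷ P a cs)

  #-cong : ∀ {P Q} cs → (∀ c → P c ≡ Q c) → # P cs ≡ # Q cs
  #-cong []       P≡Q = refl
  #-cong (c ∷ cs) P≡Q = cong₂ (λ b r → ind b ℤ.+ r) (P≡Q c) (#-cong cs P≡Q)

  #-∧ : ∀ b P cs → # (λ c → b ∧ P c) cs ≡ (if b then # P cs else + 0)
  #-∧ true  P cs       = refl
  #-∧ false P []       = refl
  #-∧ false P (c ∷ cs) = trans (ℤP.+-identityˡ _) (#-∧ false P cs)

  #-compsF : ∀ P f n → # P (compsF (suc f) (suc n)) ≡ ∑ (suc n) (λ k → # (λ c → P (suc k ∷ c)) (compsF f (n ∸ k)))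
  #-compsF P f n = trans (#-concatMap P (λ k → map (suc k ∷_) (compsF f (n ∸ k))) (λ k → k) (suc n))
                         (∑-cong (suc n) (λ k → #-map-∷ P (suc k) (compsF f (n ∸ k))))

  #-first-part : ∀ P f n (head : ℕ → Bool) (Q : ℕ → List ℕ → Bool) →
                 (∀ k c → P (suc k ∷ c) ≡ head k ∧ Q k c) →
                 # P (compsF (suc f) (suc n)) ≡ ∑ (suc n) (λ k → if head k then # (Q k) (compsF f (n ∸ k)) else + 0)
  #-first-part P f n head Q split = trans (#-compsF P f n) (∑-cong (suc n) λ k →
    trans (#-cong (compsF f (n ∸ k)) (split k)) (#-∧ (head k) (Q k) (compsF f (n ∸ k))))

  #all : (ℕ → Bool) → ℕ → ℕ → ℤ
  #all p f n = # (all p) (compsF f n)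

  #all-suc : ∀ p f n → #all p (suc f) (suc n) ≡ ∑ (suc n) (λ k → if p (suc k) then #all p f (n ∸ k) else + 0)
  #all-suc p f n = #-first-part (all p) f n (λ k → p (suc k)) (λ _ → all p) (λ _ _ → refl)

  #all-fuel : ∀ p f g n → n ℕ.≤ f → n ℕ.≤ g → #all p f n ≡ #all p g n
  #all-fuel p f       g       zero    _         _         = refl
  #all-fuel p (suc f) (suc g) (suc n) (s≤s n≤f) (s≤s n≤g) =
    trans (#all-suc p f n) (trans (∑-cong (suc n) (λ k → cong (λ z → if p (suc k) then z else + 0)
            (#all-fuel p f g (n ∸ k) (ℕP.≤-trans (ℕP.m∸n≤m n k) n≤f) (ℕP.≤-trans (ℕP.m∸n≤m n k) n≤g))))
          (sym (#all-suc p g n)))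

  countComps-suc : ∀ p n →
    + countComps p (suc n) ≡ ∑ (suc n) (λ k → if p (suc k) then + countComps p (n ∸ k) else + 0)
  countComps-suc p n = trans (length-filter (all p) (compsF (suc n) (suc n))) (trans (#all-suc p n n)
    (∑-cong (suc n) (λ k → cong (λ z → if p (suc k) then z else + 0)
      (trans (#all-fuel p n (n ∸ k) (n ∸ k) (ℕP.m∸n≤m n k) ℕP.≤-refl)
             (sym (length-filter (all p) (compsF (n ∸ k) (n ∸ k))))))))

module CompositionSeries where

  open PowerSeries
  open Coefficients using (squares; triangles)
  open Compositions using (countComps-suc)
  open Signs using (sgn-+)
  open import Defs using (s; t; sgn; isSquare; isTriangular)
  open import Data.Bool using (true; false; if_then_else_)
  open import Algebra.Properties.Ring (CommutativeRing.ring ℤ⟦x⟧) using (-‿distribʳ-*)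

  renewal : ∀ F W → W 0 ≡ + 0 → F 0 ≡ + 1 →
            (∀ n → F (suc n) ≡ ∑ (suc n) (λ k → W (suc k) ℤ.* F (n ∸ k))) → F ⊛ (𝟙 ⊕ ⊖ W) ≈ 𝟙
  renewal F W W0≡0 F0≡1 recursion = ≈-trans (⊛-distribˡ-⊕ F 𝟙 (⊖ W))
    (≈-trans (⊕-cong (⊛-identityʳ F) (≈-trans (≈-sym (-‿distribʳ-* F W)) (⊖-cong (⊛-comm F W)))) (mk≈ cancel))
    where
    cancel : ∀ n → F n ℤ.+ - (W ⊛ F) n ≡ 𝟙 n
    cancel zero    rewrite W0≡0 | F0≡1 = refl
    cancel (suc n) rewrite W0≡0 = trans (cong (λ z → F (suc n) ℤ.+ - z) (trans (ℤP.+-identityˡ _) (sym (recursion n))))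
                                        (ℤP.+-inverseʳ (F (suc n)))

  signedS : Series
  signedS n = sgn n ℤ.* + s n

  signedS-renewal : signedS ⊛ (𝟙 ⊕ ⊖ squares) ≈ 𝟙
  signedS-renewal = renewal signedS squares refl refl λ n → begin
    sgn (suc n) ℤ.* + s (suc n)
      ≡⟨ cong (sgn (suc n) ℤ.*_) (countComps-suc isSquare n) ⟩
    sgn (suc n) ℤ.* ∑ (suc n) (λ k → if isSquare (suc k) then + s (n ∸ k) else + 0)
      ≡⟨ ℤ-Sums.*-distribˡ-∑ (suc n) (λ k → if isSquare (suc k) then + s (n ∸ k) else + 0) (sgn (suc n)) ⟨
    ∑ (suc n) (λ k → sgn (suc n) ℤ.* (if isSquare (suc k) then + s (n ∸ k) else + 0))
      ≡⟨ ∑-cong-< (suc n) term ⟩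
    ∑ (suc n) (λ k → squares (suc k) ℤ.* signedS (n ∸ k))
      ∎
    where
    open ≡.≡-Reasoning
    term : ∀ {n} k → k < suc n → sgn (suc n) ℤ.* (if isSquare (suc k) then + s (n ∸ k) else + 0)
                                  ≡ squares (suc k) ℤ.* signedS (n ∸ k)
    term {n} k (s≤s k≤n) with isSquare (suc k)
    ... | true  = trans (cong (ℤ._* + s (n ∸ k)) (trans (cong (λ m → sgn (suc m)) (sym (ℕP.m+[n∸m]≡n k≤n)))
                                                         (sgn-+ (suc k) (n ∸ k))))
                        (ℤP.*-assoc (sgn (suc k)) (sgn (n ∸ k)) (+ s (n ∸ k)))
    ... | false = ℤP.*-zeroʳ (sgn (suc n))

  countT : Series
  countT n = + t n

  countT-renewal : countT ⊛ (𝟙 ⊕ ⊖ triangles) ≈ 𝟙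
  countT-renewal = renewal countT triangles refl refl λ n →
    trans (countComps-suc isTriangular n) (∑-cong (suc n) (term {n}))
    where
    term : ∀ {n} k → (if isTriangular (suc k) then + t (n ∸ k) else + 0) ≡ triangles (suc k) ℤ.* countT (n ∸ k)
    term {n} k with isTriangular (suc k)
    ... | true  = sym (ℤP.*-identityˡ (+ t (n ∸ k)))
    ... | false = refl

module WeightedProducts where

  open PowerSeries
  open GuardedSums
  open import Data.Bool using (Bool; true; false; if_then_else_; T; _∨_)

  weightedProd : (ℕ → ℤ) → ℕ → Series
  weightedProd w = ∏ (λ j → 𝟙 ⊕ w j ·x^ j)

  weightedProd-constant : ∀ w M → weightedProd w M 0 ≡ + 1
  weightedProd-constant w = ∏-constant _ (λ j → 𝟙⊕-≈< (mk≈< (λ n n<1+j → ·x^-below (w (suc j)) n<1+j)))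

  shift-coeff : ∀ d h n → shift d h n ≡ (if d ℕ.<ᵇ suc n then h (n ∸ d) else + 0)
  shift-coeff zero    h n       = refl
  shift-coeff (suc d) h zero    = refl
  shift-coeff (suc d) h (suc n) = shift-coeff d h n

  <ᵇ-suc : ∀ k B → (k ℕ.<ᵇ suc B) ≡ ((k ℕ.<ᵇ B) ∨ (k ℕ.≡ᵇ B))
  <ᵇ-suc zero    zero    = refl
  <ᵇ-suc zero    (suc B) = refl
  <ᵇ-suc (suc k) zero    = refl
  <ᵇ-suc (suc k) (suc B) = <ᵇ-suc k B

  ∑If-≡ᵇ : ∀ L d X → ∑If L (λ k → k ℕ.≡ᵇ d) X ≡ (if d ℕ.<ᵇ L then X d else + 0)
  ∑If-≡ᵇ L d X with d ℕ.<ᵇ L in d<L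
  ... | true  = ∑If-one L _ X d (ℕP.<ᵇ⇒< d L (subst T (sym d<L) _)) (ℕP.≡⇒≡ᵇ d d refl)
                        (λ k _ hit → ℕP.≡ᵇ⇒≡ k d hit)
  ... | false = ∑If-none L _ X (λ k k<L hit → subst T d<L (ℕP.<⇒<ᵇ (subst (ℕ._< L) (ℕP.≡ᵇ⇒≡ k d hit) k<L)))

  weightedProd-suc : ∀ w B n → weightedProd w B (suc n) ≡
                     ∑If (suc n) (λ k → k ℕ.<ᵇ B) (λ k → w (suc k) ℤ.* weightedProd w k (n ∸ k))
  weightedProd-suc w zero    n =
    sym (∑If-none (suc n) (λ k → k ℕ.<ᵇ 0) (λ k → w (suc k) ℤ.* weightedProd w k (n ∸ k)) (λ _ _ ()))
  weightedProd-suc w (suc B) n = begin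
    (P ⊛ (𝟙 ⊕ c ·x^ suc B)) (suc n)
      ≡⟨ coeff (⊛-distribˡ-⊕ P 𝟙 (c ·x^ suc B)) (suc n) ⟩
    (P ⊛ 𝟙) (suc n) ℤ.+ (P ⊛ c ·x^ suc B) (suc n)
      ≡⟨ cong₂ ℤ._+_ (coeff (⊛-identityʳ P) (suc n))
                     (trans (coeff (≈-trans (⊛-comm P (c ·x^ suc B)) (·x^-⊛ c (suc B) P)) (suc n))
                            (cong (c ℤ.*_) (shift-coeff B P n))) ⟩
    P (suc n) ℤ.+ c ℤ.* (if B ℕ.<ᵇ suc n then P (n ∸ B) else + 0)
      ≡⟨ cong₂ ℤ._+_ (weightedProd-suc w B n) (distribute (B ℕ.<ᵇ suc n)) ⟩
    ∑If (suc n) (λ k → k ℕ.<ᵇ B) X ℤ.+ (if B ℕ.<ᵇ suc n then X B else + 0)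
      ≡⟨ cong (ℤ._+_ (∑If (suc n) (λ k → k ℕ.<ᵇ B) X)) (∑If-≡ᵇ (suc n) B X) ⟨
    ∑If (suc n) (λ k → k ℕ.<ᵇ B) X ℤ.+ ∑If (suc n) (λ k → k ℕ.≡ᵇ B) X
      ≡⟨ ∑If-∨ (suc n) (λ k → k ℕ.<ᵇ B) (λ k → k ℕ.≡ᵇ B) X
                (λ k k<B k≡B → ℕP.<-irrefl (ℕP.≡ᵇ⇒≡ k B k≡B) (ℕP.<ᵇ⇒< k B k<B)) ⟨
    ∑If (suc n) (λ k → (k ℕ.<ᵇ B) ∨ (k ℕ.≡ᵇ B)) X
      ≡⟨ ∑-cong (suc n) (λ k → cong (λ b → if b then X k else + 0) (<ᵇ-suc k B)) ⟨
    ∑If (suc n) (λ k → k ℕ.<ᵇ suc B) X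
      ∎
    where
    open ≡.≡-Reasoning
    P = weightedProd w B
    c = w (suc B)
    X : ℕ → ℤ
    X k = w (suc k) ℤ.* weightedProd w k (n ∸ k)
    distribute : ∀ b → c ℤ.* (if b then P (n ∸ B) else + 0) ≡ (if b then c ℤ.* P (n ∸ B) else + 0)
    distribute true  = refl
    distribute false = ℤP.*-zeroʳ c

open import Data.Bool using (Bool)

module DistinctParts (p : ℕ → Bool) (χ : ℕ → ℤ)
                     (χ-0 : χ 0 ≡ + 1) (χ-+ : ∀ a b → χ (a ℕ.+ b) ≡ χ a ℤ.* χ b) where

  open PowerSeries
  open GuardedSums
  open WeightedProducts
  open Compositions using (#; #-first-part)
  open import Defs using (compsF; strictDec)
  open import Data.Bool using (Bool; true; false; if_then_else_; _∧_; T)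
  open import Data.Bool.Properties using (∧-zeroʳ)
  open import Data.Bool.ListAction using (all)
  open import Data.List using (List; []; _∷_)
  open import Data.Empty using (⊥-elim)

  weight : ℕ → ℤ
  weight j = if p j then χ j else + 0

  headBelow : ℕ → List ℕ → Bool
  headBelow b []      = true
  headBelow b (y ∷ _) = y ℕ.<ᵇ b

  admissible : ℕ → List ℕ → Bool
  admissible b c = (headBelow b c ∧ strictDec c) ∧ all p c

  strictDec-∷ : ∀ a c → strictDec (a ∷ c) ≡ headBelow a c ∧ strictDec c
  strictDec-∷ a []       = refl
  strictDec-∷ a (y ∷ ys) = refl

  admissible-∷ : ∀ b a c → admissible b (a ∷ c) ≡ ((a ℕ.<ᵇ b) ∧ p a) ∧ admissible a c
  admissible-∷ b a c rewrite strictDec-∷ a c with a ℕ.<ᵇ b | p a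
  ... | true  | true  = refl
  ... | true  | false = ∧-zeroʳ (headBelow a c ∧ strictDec c)
  ... | false | _     = refl

  distinct-∷ : ∀ a c → (strictDec (a ∷ c) ∧ all p (a ∷ c)) ≡ p a ∧ admissible a c
  distinct-∷ a c rewrite strictDec-∷ a c with p a
  ... | true  = refl
  ... | false = ∧-zeroʳ (headBelow a c ∧ strictDec c)

  #bounded : ℕ → ℕ → ℕ → ℤ
  #bounded f n b = # (admissible b) (compsF f n)

  private
    split-χ : ∀ {n k} → k ℕ.≤ n → ∀ x → χ (suc n) ℤ.* x ≡ χ (suc k) ℤ.* (χ (n ∸ k) ℤ.* x)
    split-χ {n} {k} k≤n x = trans (cong (λ m → χ (suc m) ℤ.* x) (sym (ℕP.m+[n∸m]≡n k≤n)))
                                  (trans (cong (ℤ._* x) (χ-+ (suc k) (n ∸ k))) (ℤP.*-assoc (χ (suc k)) (χ (n ∸ k)) x))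

  #bounded≡weightedProd : ∀ f n B → n ℕ.≤ f → χ n ℤ.* #bounded f n (suc B) ≡ weightedProd weight B n
  #bounded≡weightedProd f       zero    B _ = trans (cong (ℤ._* + 1) χ-0) (sym (weightedProd-constant weight B))
  #bounded≡weightedProd (suc f) (suc n) B (s≤s n≤f) = begin
    χ (suc n) ℤ.* #bounded (suc f) (suc n) (suc B)
      ≡⟨ cong (χ (suc n) ℤ.*_) (#-first-part (admissible (suc B)) f n (λ k → (suc k ℕ.<ᵇ suc B) ∧ p (suc k))
                                             (λ k → admissible (suc k)) (λ k → admissible-∷ (suc B) (suc k))) ⟩
    χ (suc n) ℤ.* ∑ (suc n) F
      ≡⟨ ℤ-Sums.*-distribˡ-∑ (suc n) F (χ (suc n)) ⟨
    ∑ (suc n) (λ k → χ (suc n) ℤ.* F k)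
      ≡⟨ ∑-cong-< (suc n) term ⟩
    ∑If (suc n) (λ k → k ℕ.<ᵇ B) (λ k → weight (suc k) ℤ.* weightedProd weight k (n ∸ k))
      ≡⟨ weightedProd-suc weight B n ⟨
    weightedProd weight B (suc n)
      ∎
    where
    open ≡.≡-Reasoning
    F : ℕ → ℤ
    F k = if (k ℕ.<ᵇ B) ∧ p (suc k) then #bounded f (n ∸ k) (suc k) else + 0
    term : ∀ k → k < suc n →
           χ (suc n) ℤ.* F k ≡ (if k ℕ.<ᵇ B then weight (suc k) ℤ.* weightedProd weight k (n ∸ k) else + 0)
    term k (s≤s k≤n) with k ℕ.<ᵇ B | p (suc k)
    ... | true  | true  = trans (split-χ k≤n _)
                                (cong (χ (suc k) ℤ.*_) (#bounded≡weightedProd f (n ∸ k) k (ℕP.≤-trans (ℕP.m∸n≤m n k) n≤f)))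
    ... | true  | false = ℤP.*-zeroʳ (χ (suc n))
    ... | false | _     = ℤP.*-zeroʳ (χ (suc n))

  #distinct : ℕ → ℤ
  #distinct n = # (λ c → strictDec c ∧ all p c) (compsF n n)

  weightedProd-limit : ∀ M → weightedProd weight M ≈[< suc M ] (λ n → χ n ℤ.* #distinct n)
  weightedProd-limit M = mk≈< coefficient
    where
    open ≡.≡-Reasoning
    F : ℕ → ℕ → ℤ
    F n k = if p (suc k) then #bounded n (n ∸ k) (suc k) else + 0
    term : ∀ {n} → n < M → ∀ k → k < suc n →
           χ (suc n) ℤ.* F n k ≡ (if k ℕ.<ᵇ M then weight (suc k) ℤ.* weightedProd weight k (n ∸ k) else + 0)
    term {n} n<M k (s≤s k≤n) with k ℕ.<ᵇ M in k<M | p (suc k)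
    ... | true  | true  = trans (split-χ k≤n _) (cong (χ (suc k) ℤ.*_) (#bounded≡weightedProd n (n ∸ k) k (ℕP.m∸n≤m n k)))
    ... | true  | false = ℤP.*-zeroʳ (χ (suc n))
    ... | false | _     = ⊥-elim (subst T k<M (ℕP.<⇒<ᵇ (ℕP.≤-<-trans k≤n n<M)))
    coefficient : ∀ n → n < suc M → weightedProd weight M n ≡ χ n ℤ.* #distinct n
    coefficient zero    _         = trans (weightedProd-constant weight M) (sym (cong (ℤ._* + 1) χ-0))
    coefficient (suc n) (s≤s n<M) = begin
      weightedProd weight M (suc n)
        ≡⟨ weightedProd-suc weight M n ⟩
      ∑If (suc n) (λ k → k ℕ.<ᵇ M) (λ k → weight (suc k) ℤ.* weightedProd weight k (n ∸ k))
        ≡⟨ ∑-cong-< (suc n) (term n<M) ⟨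
      ∑ (suc n) (λ k → χ (suc n) ℤ.* F n k)
        ≡⟨ ℤ-Sums.*-distribˡ-∑ (suc n) (F n) (χ (suc n)) ⟩
      χ (suc n) ℤ.* ∑ (suc n) (F n)
        ≡⟨ cong (χ (suc n) ℤ.*_) (#-first-part _ n n (λ k → p (suc k)) (λ k → admissible (suc k))
                                                (λ k → distinct-∷ (suc k))) ⟨
      χ (suc n) ℤ.* #distinct (suc n)
        ∎

module DistinctPartitions where

  open PowerSeries
  open Products
  open WeightedProducts
  open Compositions using (#-cong; length-filter)
  open import Defs using (q; qq; sgn; isOdd; strictDec; compsF)
  open import Data.Bool using (true; _∧_)
  open import Data.Bool.Properties using (∧-identityʳ)
  open import Data.Bool.ListAction using (all)
  open import Data.List using (List; []; _∷_)
  open import Data.Nat.DivMod using (_%_; [m+kn]%n≡m%n)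
  open import Data.Nat.Tactic.RingSolver using (solve-∀)

  module AllParts = DistinctParts (λ _ → true) (λ _ → + 1) refl (λ _ _ → refl)
  module OddParts = DistinctParts isOdd sgn refl Signs.sgn-+

  Q : Series
  Q n = + q n

  signedQQ : Series
  signedQQ n = sgn n ℤ.* + qq n

  distinctProd-limit : ∀ M → distinctProd M ≈[< suc M ] Q
  distinctProd-limit M = ≈<-trans (AllParts.weightedProd-limit M) (mk≈< λ n _ →
    trans (ℤP.*-identityˡ _) (sym (trans (length-filter strictDec (compsF n n)) (#-cong (compsF n n) (λ c → sym (all-parts c))))))
    where
    all-parts : ∀ c → strictDec c ∧ all (λ _ → true) c ≡ strictDec c
    all-parts c = trans (cong (strictDec c ∧_) (all-true c)) (∧-identityʳ (strictDec c))
      where all-true : ∀ (c : List ℕ) → all (λ _ → true) c ≡ true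
            all-true []      = refl
            all-true (_ ∷ c) = all-true c

  oddProd-weighted : ∀ N → oddProd N ≈ weightedProd OddParts.weight (N ℕ.+ N)
  oddProd-weighted zero    = ≈-refl
  oddProd-weighted (suc N) = ≈-sym (begin
    weightedProd w (suc N ℕ.+ suc N)
      ≡⟨ cong (weightedProd w) (cong suc (ℕP.+-suc N N)) ⟩
    weightedProd w (N ℕ.+ N) ⊛ (𝟙 ⊕ w (suc (N ℕ.+ N)) ·x^ suc (N ℕ.+ N))
                             ⊛ (𝟙 ⊕ w (suc (suc (N ℕ.+ N))) ·x^ suc (suc (N ℕ.+ N)))
      ≈⟨ ⊛-cong (⊛-cong (≈-sym (oddProd-weighted N)) (⊕-congˡ 𝟙 odd-factor)) (⊕-congˡ 𝟙 even-factor) ⟩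
    oddProd N ⊛ (𝟙 ⊕ ⊖ x^ (suc N ℕ.+ N)) ⊛ (𝟙 ⊕ 𝟘)
      ≈⟨ ≈-trans (⊛-congˡ (oddProd (suc N)) (mk≈ (λ n → ℤP.+-identityʳ (𝟙 n)))) (⊛-identityʳ (oddProd (suc N))) ⟩
    oddProd (suc N)
      ∎)
    where
    open SeriesAlgebra using (module ≈-Reasoning)
    open ≈-Reasoning
    w = OddParts.weight
    parity : ∀ r → isOdd (r ℕ.+ (N ℕ.+ N)) ≡ isOdd r
    parity r = cong (ℕ._≡ᵇ 1) (trans (cong (λ k → (r ℕ.+ k) % 2) (double N)) ([m+kn]%n≡m%n r N 2))
      where double : ∀ N → N ℕ.+ N ≡ N ℕ.* 2
            double = solve-∀
    odd-factor : w (suc (N ℕ.+ N)) ·x^ suc (N ℕ.+ N) ≈ ⊖ x^ (suc N ℕ.+ N)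
    odd-factor rewrite parity 1 = neg-x^ {e = suc (N ℕ.+ N)} (Signs.sgn-odd N) refl
    even-factor : w (suc (suc (N ℕ.+ N))) ·x^ suc (suc (N ℕ.+ N)) ≈ 𝟘
    even-factor rewrite parity 2 = zero-·x^ (suc (suc (N ℕ.+ N)))

  oddProd-limit : ∀ N → oddProd N ≈[< suc (N ℕ.+ N) ] signedQQ
  oddProd-limit N = ≈<-trans (≈⇒≈< (suc (N ℕ.+ N)) (oddProd-weighted N))
                    (≈<-trans (OddParts.weightedProd-limit (N ℕ.+ N))
                              (mk≈< λ n _ → cong (sgn n ℤ.*_) (sym (length-filter _ (compsF n n)))))

module ProductIdentities where

  open PowerSeries
  open SeriesAlgebra
  open Products
  open Specialisations
  open Coefficients
  open DistinctPartitions
  open import Defs using (ω; ω′)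

  θ ψ : Series
  θ = 𝟙 ⊕ (squares ⊕ squares)
  ψ = 𝟙 ⊕ triangles

  θ⊛Q≈ω : θ ⊛ Q ≈ ω
  θ⊛Q≈ω = ≈-from-≈< truncated
    where
    truncated : ∀ N → θ ⊛ Q ≈[< N ] ω
    truncated N = begin
      θ ⊛ Q
        ≈⟨ ⊛-congʳ-≈< Q (≈<-sym (≈<-trans (Theta.product-limit N) (theta-limit N))) ⟩
      Theta.product N ⊛ Theta.poch N ⊛ Q
        ≈⟨ ≈⇒≈< N (⊛-congʳ Q (theta-regroup N)) ⟩
      O ⊛ O ⊛ E₂ ⊛ Q
        ≈⟨ ⊛-congˡ-≈< (O ⊛ O ⊛ E₂) (≈<-sym (≈<-weaken N≤1+2N (distinctProd-limit (N ℕ.+ N)))) ⟩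
      O ⊛ O ⊛ E₂ ⊛ D
        ≈⟨ ≈⇒≈< N (solve 3 (λ o e d → o :* o :* e :* d := o :* (d :* (o :* e))) ≈-refl O E₂ D) ⟩
      O ⊛ (D ⊛ (O ⊛ E₂))
        ≈⟨ ≈⇒≈< N (⊛-congˡ O (≈-trans (⊛-congˡ D (≈-sym (eulerProd-double N))) (distinct-euler (N ℕ.+ N)))) ⟩
      O ⊛ eulerProd 2 (N ℕ.+ N)
        ≈⟨ ⊛-congˡ-≈< O (≈<-weaken (ℕP.n≤1+n N) (eulerProd-stabilise 1 (ℕP.m≤m+n N N))) ⟩
      O ⊛ E₂
        ≈⟨ ≈⇒≈< N (≈-sym (eulerProd-double N)) ⟩
      eulerProd 1 (N ℕ.+ N)
        ≈⟨ ≈<-weaken (ℕP.n≤1+n N) (≈<-trans (eulerProd-stabilise 0 (ℕP.m≤m+n N N))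
                                             (≈<-sym (eulerProd-stabilise 0 (ℕP.m≤m*n N 3)))) ⟩
      eulerProd 1 (N ℕ.* 3)
        ≈⟨ ≈⇒≈< N (≈-sym (pentagonal-regroup 0 N)) ⟩
      Pentagonal.product 0 N ⊛ Pentagonal.poch 0 N
        ≈⟨ ≈<-trans (Pentagonal.product-limit 0 N) (omega-limit N) ⟩
      ω
        ∎
      where
      open ≈<-Reasoning N
      O = oddProd N ; E₂ = eulerProd 2 N ; D = distinctProd (N ℕ.+ N)
      N≤1+2N : N ℕ.≤ suc (N ℕ.+ N)
      N≤1+2N = ℕP.≤-trans (ℕP.m≤m+n N N) (ℕP.n≤1+n _)

  scale-2-cancel : ∀ {f g m} → scale (+ 2) f ≈[< m ] scale (+ 2) g → f ≈[< m ] g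
  scale-2-cancel {f} {g} 2f≈2g = mk≈< (λ n n<m → ℤP.*-cancelˡ-≡ (+ 2) (f n) (g n) (below 2f≈2g n n<m))

  ψ⊛signedQQ≈ω′ : ψ ⊛ signedQQ ≈ ω′
  ψ⊛signedQQ≈ω′ = ≈-from-≈< truncated
    where
    truncated : ∀ N → ψ ⊛ signedQQ ≈[< N ] ω′
    truncated zero    = mk≈< (λ _ ())
    truncated (suc K) = begin
      ψ ⊛ signedQQ
        ≈⟨ ⊛-congˡ-≈< ψ (≈<-sym (≈<-weaken N≤1+2N (oddProd-limit N))) ⟩
      ψ ⊛ O
        ≈⟨ ⊛-congʳ-≈< O (≈<-sym ψ-product) ⟩
      Dₙ ⊛ Dₖ ⊛ E₁ ⊛ O
        ≈⟨ ≈⇒≈< N (solve 4 (λ a b e o → a :* b :* e :* o := (a :* e) :* (b :* o)) ≈-refl Dₙ Dₖ E₁ O) ⟩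
      Dₙ ⊛ E₁ ⊛ (Dₖ ⊛ O)
        ≈⟨ ≈⇒≈< N (⊛-congʳ (Dₖ ⊛ O) (distinct-euler N)) ⟩
      E₂ ⊛ (Dₖ ⊛ O)
        ≈⟨ ⊛-congˡ-≈< E₂ (⊛-congʳ-≈< O (≈<-sym (distinctProd-stabilise K≤2N))) ⟩
      E₂ ⊛ (distinctProd (N ℕ.+ N) ⊛ O)
        ≈⟨ ⊛-congˡ-≈< E₂ (≈<-weaken (ℕP.n≤1+n N) (distinct-odd N)) ⟩
      E₂ ⊛ 𝟙
        ≈⟨ ≈⇒≈< N (⊛-identityʳ E₂) ⟩
      E₂
        ≈⟨ ≈<-sym (≈<-weaken (ℕP.n≤1+n N) (eulerProd-stabilise 1 (ℕP.m≤m*n N 3))) ⟩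
      eulerProd 2 (N ℕ.* 3)
        ≈⟨ ≈⇒≈< N (≈-sym (pentagonal-regroup 1 N)) ⟩
      Pentagonal.product 1 N ⊛ Pentagonal.poch 1 N
        ≈⟨ ≈<-trans (Pentagonal.product-limit 1 N) (omega′-limit N) ⟩
      ω′
        ∎
      where
      open ≈<-Reasoning (suc K)
      N = suc K
      O = oddProd N ; Dₙ = distinctProd N ; Dₖ = distinctProd K ; E₁ = eulerProd 1 N ; E₂ = eulerProd 2 N
      N≤1+2N : N ℕ.≤ suc (N ℕ.+ N)
      N≤1+2N = ℕP.≤-trans (ℕP.m≤m+n N N) (ℕP.n≤1+n _)
      K≤2N : K ℕ.≤ N ℕ.+ N
      K≤2N = ℕP.≤-trans (ℕP.n≤1+n K) (ℕP.m≤m+n N N)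
      ψ-product : Dₙ ⊛ Dₖ ⊛ E₁ ≈[< N ] ψ
      ψ-product = scale-2-cancel (begin
        scale (+ 2) (Dₙ ⊛ Dₖ ⊛ E₁)            ≈⟨ ≈⇒≈< N (≈-sym (scale-⊛ (+ 2) (Dₙ ⊛ Dₖ) E₁)) ⟩
        scale (+ 2) (Dₙ ⊛ Dₖ) ⊛ E₁            ≈⟨ ≈⇒≈< N (⊛-congʳ E₁ (≈-sym (⊛-scale (+ 2) Dₙ Dₖ))) ⟩
        Dₙ ⊛ scale (+ 2) Dₖ ⊛ E₁              ≈⟨ ≈⇒≈< N (⊛-congʳ E₁ (⊛-congˡ Dₙ (≈-sym (distinctProd₀-suc K)))) ⟩
        Dₙ ⊛ distinctProd₀ N ⊛ E₁             ≈⟨ ≈⇒≈< N (≈-sym (psi-regroup N)) ⟩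
        Psi.product N ⊛ Psi.poch N            ≈⟨ ≈<-trans (Psi.product-limit N) (psi-limit N) ⟩
        scale (+ 2) ψ                         ∎)

module CoefficientIdentities where

  open PowerSeries
  open SeriesAlgebra
  open Coefficients using (squares; triangles)
  open CompositionSeries
  open DistinctPartitions
  open ProductIdentities
  open import Defs using (q; qq; sgn; ω; ω′; sumTo)
  open import Data.List using (applyUpTo; foldr)
  open import Data.Integer.Tactic.RingSolver using (solve-∀)

  sumTo-convolution : ∀ f g n → sumTo n (λ k → f k ℤ.* g (n ∸ k)) ≡ (f ⊛ g) n
  sumTo-convolution f g n = go (suc n) (λ k → k)
    where
    go : ∀ L h → foldr (λ k acc → f k ℤ.* g (n ∸ k) ℤ.+ acc) (+ 0) (applyUpTo h L)
                 ≡ ∑ L (λ i → f (h i) ℤ.* g (n ∸ h i))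
    go zero    h = refl
    go (suc L) h = cong (ℤ._+_ (f (h 0) ℤ.* g (n ∸ h 0))) (go L (λ i → h (suc i)))

  factor-a factor-b : Series
  factor-a m = + 3 ℤ.* Q m ℤ.- ω m
  factor-b m = + 2 ℤ.* sgn m ℤ.* + qq m ℤ.- ω′ m

  part-a : signedS ⊛ factor-a ≈ scale (+ 2) Q
  part-a = begin
    signedS ⊛ factor-a
      ≈⟨ ⊛-congˡ signedS (mk≈ λ m → cong₂ ℤ._+_ (triple (Q m)) (cong -_ (sym (coeff θ⊛Q≈ω m)))) ⟩
    signedS ⊛ (Q ⊕ Q ⊕ Q ⊕ ⊖ (θ ⊛ Q))
      ≈⟨ solve 3 (λ s u f → s :* (f :+ f :+ f :- (:1 :+ (u :+ u)) :* f) := (f :+ f) :* (s :* (:1 :- u)))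
                 ≈-refl signedS squares Q ⟩
    (Q ⊕ Q) ⊛ (signedS ⊛ (𝟙 ⊕ ⊖ squares))
      ≈⟨ ≈-trans (⊛-congˡ (Q ⊕ Q) signedS-renewal) (⊛-identityʳ (Q ⊕ Q)) ⟩
    Q ⊕ Q
      ≈⟨ mk≈ (λ m → double (Q m)) ⟩
    scale (+ 2) Q
      ∎
    where
    open ≈-Reasoning
    triple : ∀ a → + 3 ℤ.* a ≡ a ℤ.+ a ℤ.+ a
    triple = solve-∀
    double : ∀ a → a ℤ.+ a ≡ + 2 ℤ.* a
    double = solve-∀

  part-b : countT ⊛ factor-b ≈ signedQQ
  part-b = begin
    countT ⊛ factor-b
      ≈⟨ ⊛-congˡ countT (mk≈ λ m → cong₂ ℤ._+_ (double (sgn m) (+ qq m))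
                                               (cong -_ (sym (coeff ψ⊛signedQQ≈ω′ m)))) ⟩
    countT ⊛ (signedQQ ⊕ signedQQ ⊕ ⊖ (ψ ⊛ signedQQ))
      ≈⟨ solve 3 (λ t u f → t :* (f :+ f :- (:1 :+ u) :* f) := f :* (t :* (:1 :- u)))
                 ≈-refl countT triangles signedQQ ⟩
    signedQQ ⊛ (countT ⊛ (𝟙 ⊕ ⊖ triangles))
      ≈⟨ ≈-trans (⊛-congˡ signedQQ countT-renewal) (⊛-identityʳ signedQQ) ⟩
    signedQQ
      ∎
    where
    open ≈-Reasoning
    double : ∀ a b → + 2 ℤ.* a ℤ.* b ≡ a ℤ.* b ℤ.+ a ℤ.* b
    double = solve-∀

open import Defs
open import Data.Nat using (ℕ; _∸_)
open import Data.Integer using (ℤ; +_; _+_; _-_; _*_)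
open import Data.Product using (_×_; _,_)
open import Relation.Binary.PropositionalEquality using (_≡_)

theorem4 : (n : ℕ) →
    (sumTo n (λ k → sgn k * (+ s k) * (+ 3 * + q (n ∸ k) - ω (n ∸ k))) ≡ + 2 * + q n)
    × (sumTo n (λ k → + t k * (+ 2 * sgn (n ∸ k) * + qq (n ∸ k) - ω′ (n ∸ k))) ≡ sgn n * + qq n)
theorem4 n = ≡.trans (sumTo-convolution signedS factor-a n) (coeff part-a n)
           , ≡.trans (sumTo-convolution countT factor-b n) (coeff part-b n)
  where
  open CoefficientIdentities
  open PowerSeries using (coeff)
  open CompositionSeries using (signedS; countT)
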